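{- Let $\mathcal C$ be a coherent configuration on a point set $V$, and let $X\ne Y$ be fibers of $\mathcal C$ such that $\mathcal C[X,Y]$ contains a matching basis relation. Then $\mathcal C$ is separable if and only if $\mathcal C\setminus X$ is separable.
   Context: A coherent configuration on a finite set $V$ is a partition $\mathcal C$ of $V\times V$ into basis relations such that: (A) a basis relation containing a loop consists of loops; (B) the transpose $R^*=\{uv:vu\in R\}$ of a basis relation is a basis relation; (C) for all $R,S,T\in\mathcal C$ the number $|\{w:uw\in R,wv\in S\}|$ is the same for all $uv\in T$, denoted $p^T_{RS}$. A fiber is a set $X$ with $\{xx:x\in X\}\in\mathcal C$; fibers partition $V$. $\mathcal C[X,Y]$ is the set of basis relations contained in $X\times Y$. A basis relation $M\in\mathcal C[X,Y]$, $X\ne Y$, is a matching if every $x\in X$ has exactly one $y$ with $xy\in M$ and every $y\in Y$ has exactly one $x$ with $xy\in M$. For a fiber $X$, $\mathcal C\setminus X$ denotes the coherent configuration on $V\setminus X$ consisting of the basis relations contained in $(V\setminus X)^2$. Combinatorial isomorphism: bijection $\phi$ of point sets with $\phi(R)\in\mathcal C'$ for all $R\in\mathcal C$; algebraic isomorphism: bijection $f:\mathcal C\to\mathcal C'$ with $p^T_{RS}=p^{f(T)}_{f(R)f(S)}$; $f$ is induced by $\phi$ if $f(R)=\phi(R)$ for all $R$. $\mathcal C$ is separable if every algebraic isomorphism from $\mathcal C$ to any coherent configuration is induced by a combinatorial isomorphism. -}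

module Defs where

open import Data.Nat using (ℕ)
open import Data.Fin using (Fin)
open import Data.Fin.Properties using (_≟_)
open import Data.Fin.Subset using (Subset; _∈_; _∉_; ∁; _∩_)
open import Data.Fin.Subset.Properties using (_∈?_)
open import Data.Vec using (tabulate)
open import Data.List using (List; length; filter; allFin)
open import Data.Product using (Σ; ∃; _×_; _,_)
open import Relation.Binary.PropositionalEquality using (_≡_)
open import Relation.Nullary using (¬_; does)
open import Relation.Nullary.Decidable using (_×-dec_)

-- A (colour-coded) configuration: the point set V is the subset `pts` of Fin n,
-- and the pair uv (u v ∈ V) lies in the basis relation with colour `col u v`.
-- Basis relations are the nonempty colour classes on V × V (unused colours are
-- ignored; colours of pairs outside V × V are irrelevant).
record Config : Set where
  field
    n   : ℕ
    r   : ℕ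
    pts : Subset n
    col : Fin n → Fin n → Fin r
open Config public

Used : (C : Config) → Fin (r C) → Set
Used C k = Σ (Fin (n C)) λ u → Σ (Fin (n C)) λ v → u ∈ pts C × v ∈ pts C × col C u v ≡ k

count : (C : Config) → Fin (n C) → Fin (n C) → Fin (r C) → Fin (r C) → ℕ
count C u v R S =
  length (filter (λ w → (w ∈? pts C) ×-dec ((col C u w ≟ R) ×-dec (col C w v ≟ S))) (allFin (n C)))

record IsCC (C : Config) : Set where
  field
    loops     : ∀ u v w → u ∈ pts C → v ∈ pts C → w ∈ pts C →
                col C u u ≡ col C v w → v ≡ w
    transpose : ∀ u v u' v' → u ∈ pts C → v ∈ pts C → u' ∈ pts C → v' ∈ pts C →
                col C u v ≡ col C u' v' → col C v u ≡ col C v' u'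
    regular   : ∀ u v u' v' → u ∈ pts C → v ∈ pts C → u' ∈ pts C → v' ∈ pts C →
                col C u v ≡ col C u' v' → ∀ R S → count C u v R S ≡ count C u' v' R S

record AlgIso (C D : Config) : Set where
  field
    f         : Fin (r C) → Fin (r D)
    f-used    : ∀ k → Used C k → Used D (f k)
    f-inj     : ∀ k k' → Used C k → Used C k' → f k ≡ f k' → k ≡ k'
    f-surj    : ∀ k' → Used D k' → Σ (Fin (r C)) λ k → Used C k × f k ≡ k'
    f-numbers : ∀ R S → Used C R → Used C S →
                ∀ u v u' v' → u ∈ pts C → v ∈ pts C → u' ∈ pts D → v' ∈ pts D →
                col D u' v' ≡ f (col C u v) →
                count D u' v' (f R) (f S) ≡ count C u v R S

record Induces (C D : Config) (iso : AlgIso C D) : Set where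
  field
    φ       : Fin (n C) → Fin (n D)
    φ-pts   : ∀ u → u ∈ pts C → φ u ∈ pts D
    φ-inj   : ∀ u v → u ∈ pts C → v ∈ pts C → φ u ≡ φ v → u ≡ v
    φ-surj  : ∀ u' → u' ∈ pts D → Σ (Fin (n C)) λ u → u ∈ pts C × φ u ≡ u'
    φ-col   : ∀ u v → u ∈ pts C → v ∈ pts C →
              col D (φ u) (φ v) ≡ AlgIso.f iso (col C u v)

Separable : Config → Set
Separable C = (D : Config) → IsCC D → (iso : AlgIso C D) → Induces C D iso

-- colour i is the colour of a fiber, i.e. {xx : x ∈ X} is a basis relation
IsFiber : (C : Config) → Fin (r C) → Set
IsFiber C i = Σ (Fin (n C)) λ x → x ∈ pts C × col C x x ≡ i

fiberSet : (C : Config) → Fin (r C) → Subset (n C)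
fiberSet C i = pts C ∩ tabulate (λ x → does (col C x x ≟ i))

removeFiber : (C : Config) → Fin (r C) → Config
removeFiber C i = record { n = n C ; r = r C ; pts = pts C ∩ ∁ (fiberSet C i) ; col = col C }

InFiber : (C : Config) → Fin (r C) → Fin (n C) → Set
InFiber C i x = x ∈ pts C × col C x x ≡ i

HasMatching : (C : Config) → Fin (r C) → Fin (r C) → Set
HasMatching C i j = Σ (Fin (r C)) λ k →
    Used C k
  × (∀ u v → u ∈ pts C → v ∈ pts C → col C u v ≡ k → InFiber C i u × InFiber C j v)
  × (∀ x → InFiber C i x → Σ (Fin (n C)) λ y → (y ∈ pts C × col C x y ≡ k)
        × (∀ y' → y' ∈ pts C → col C x y' ≡ k → y' ≡ y))
  × (∀ y → InFiber C j y → Σ (Fin (n C)) λ x → (x ∈ pts C × col C x y ≡ k)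
        × (∀ x' → x' ∈ pts C → col C x' y ≡ k → x' ≡ x))

-- Let M be the matching between the fibers X and Y.
--
-- If C ∖ X is separable, an algebraic isomorphism f of C restricts to C ∖ X, where it is induced
-- by some φ. By the intersection numbers f(M) is again a matching between f(X) and f(Y), so φ
-- extends to X by sending x to the f(M)-copartner of φ(y), y the M-partner of x; the numbers
-- p^T_{RS} then force every colour of a pair meeting X to be the right one.
--
-- Conversely, fold X onto Y along M: with σ u recording whether u ∈ X and π u the M-partner of u
-- (or u itself), the colour of uv is determined by, and determines, (σ u, σ v, col (π u) (π v)).
-- Hence an algebraic isomorphism from C ∖ X to D' lifts to one from C to D' with a second copy of
-- the fiber f(Y) attached, and a combinatorial isomorphism inducing the lift restricts to one
-- inducing the original isomorphism.

module Submission where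

open import Defs
open import Data.Bool using (Bool; true; false)
import Data.Bool.Properties as Bool
open import Data.Empty using (⊥-elim)
open import Data.Fin using (Fin; zero; suc; _↑ˡ_; _↑ʳ_; splitAt)
open import Data.Fin.Properties
  using (_≟_; 0≢1+n; suc-injective; ¬Fin0; any?; splitAt-↑ˡ; splitAt-↑ʳ; splitAt⁻¹-↑ˡ; splitAt⁻¹-↑ʳ)
open import Data.Fin.Subset using (_∈_)
open import Data.Fin.Subset.Properties using (_∈?_; x∈p∩q⁺; x∈p∩q⁻; x∈∁p⇒x∉p; x∉p⇒x∈∁p)
import Data.List as List
open import Data.Nat using (ℕ; zero; suc; _+_; _≤_; z≤n; s≤s)
open import Data.Nat.Properties using (+-suc)
open import Data.Product using (Σ; _×_; _,_; proj₁; proj₂)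
open import Data.Sum using (inj₁; inj₂; [_,_]′)
open import Data.Vec using (tabulate)
open import Data.Vec.Properties using (lookup∘tabulate; []=⇒lookup; lookup⇒[]=)
open import Function using (id)
open import Function.Bundles using (_⇔_; mk⇔)
open import Relation.Binary.PropositionalEquality
  using (_≡_; _≢_; refl; sym; trans; cong; cong₂; subst; subst₂; module ≡-Reasoning)
open import Relation.Nullary using (¬_; Dec; yes; no; does; contradiction)
open import Relation.Nullary.Decidable using (_×-dec_; ¬?; dec-true; toSum)
open import Relation.Unary using (Decidable)

size : ∀ {n} {P : Fin n → Set} → Decidable P → ℕ
size {zero}  P? = 0
size {suc n} P? with P? zero
... | yes _ = suc (size (λ x → P? (suc x)))
... | no  _ = size (λ x → P? (suc x))

size-cong : ∀ {n} {P Q : Fin n → Set} (P? : Decidable P) (Q? : Decidable Q) →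
            (∀ x → P x → Q x) → (∀ x → Q x → P x) → size P? ≡ size Q?
size-cong {zero}  P? Q? P⇒Q Q⇒P = refl
size-cong {suc n} P? Q? P⇒Q Q⇒P with P? zero | Q? zero
... | yes p | yes q = cong suc (size-cong _ _ (λ x → P⇒Q (suc x)) (λ x → Q⇒P (suc x)))
... | yes p | no ¬q = ⊥-elim (¬q (P⇒Q zero p))
... | no ¬p | yes q = ⊥-elim (¬p (Q⇒P zero q))
... | no ¬p | no ¬q = size-cong _ _ (λ x → P⇒Q (suc x)) (λ x → Q⇒P (suc x))

size-empty : ∀ {n} {P : Fin n → Set} (P? : Decidable P) → (∀ x → ¬ P x) → size P? ≡ 0
size-empty {zero}  P? ¬P = refl
size-empty {suc n} P? ¬P with P? zero
... | yes p = ⊥-elim (¬P zero p)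
... | no  _ = size-empty _ (λ x → ¬P (suc x))

size-witness : ∀ {n} {P : Fin n → Set} (P? : Decidable P) → 1 ≤ size P? → Σ (Fin n) P
size-witness {suc n} P? pos with P? zero
... | yes p = zero , p
... | no  _ with size-witness (λ x → P? (suc x)) pos
...   | x , p = suc x , p

size-positive : ∀ {n} {P : Fin n → Set} (P? : Decidable P) x → P x → 1 ≤ size P?
size-positive {suc n} P? x p with P? zero
size-positive P? x       p | yes _ = s≤s z≤n
size-positive P? zero    p | no ¬p = ⊥-elim (¬p p)
size-positive P? (suc x) p | no  _ = size-positive (λ y → P? (suc y)) x p

size-singleton : ∀ {n} {P : Fin n → Set} (P? : Decidable P) a → P a → (∀ x → P x → x ≡ a) → size P? ≡ 1
size-singleton {suc n} P? a pa unique with P? zero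
size-singleton P? zero    pa unique | yes _  =
  cong suc (size-empty _ (λ x px → 0≢1+n (sym (unique (suc x) px))))
size-singleton P? (suc a) pa unique | yes p0 = ⊥-elim (0≢1+n (unique zero p0))
size-singleton P? zero    pa unique | no ¬p0 = ⊥-elim (¬p0 pa)
size-singleton P? (suc a) pa unique | no  _  =
  size-singleton (λ y → P? (suc y)) a pa (λ x px → suc-injective (unique (suc x) px))

size-partition : ∀ {n} {P A : Fin n → Set} (P? : Decidable P) (A? : Decidable A) →
                 size P? ≡ size (λ x → P? x ×-dec A? x) + size (λ x → P? x ×-dec ¬? (A? x))
size-partition {zero}  P? A? = refl
size-partition {suc n} P? A? with P? zero | A? zero
... | yes _ | yes _ = cong suc (size-partition (λ x → P? (suc x)) (λ x → A? (suc x)))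
... | yes _ | no  _ = trans (cong suc (size-partition (λ x → P? (suc x)) (λ x → A? (suc x)))) (sym (+-suc _ _))
... | no  _ | yes _ = size-partition (λ x → P? (suc x)) (λ x → A? (suc x))
... | no  _ | no  _ = size-partition (λ x → P? (suc x)) (λ x → A? (suc x))

size≡1⇒unique : ∀ {n} {P : Fin n → Set} (P? : Decidable P) → size P? ≡ 1 → ∀ a b → P a → P b → a ≡ b
size≡1⇒unique P? size≡1 a b pa pb with a ≟ b
... | yes a≡b = a≡b
... | no  a≢b = ⊥-elim (2≰1 (subst (2 ≤_) size≡1 2≤size))
  where
  2≰1 : ¬ (2 ≤ 1)
  2≰1 (s≤s ())
  2≤size : 2 ≤ size P?
  2≤size rewrite size-partition P? (_≟ a)
               | size-singleton (λ x → P? x ×-dec (x ≟ a)) a (pa , refl) (λ _ → proj₂) =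
    s≤s (size-positive _ b (pb , λ b≡a → a≢b (sym b≡a)))

size-+ : ∀ {a b} {P : Fin (a + b) → Set} (P? : Decidable P) →
         size P? ≡ size (λ x → P? (x ↑ˡ b)) + size (λ x → P? (a ↑ʳ x))
size-+ {zero}      P? = refl
size-+ {suc a} {b} P? with P? zero
... | yes _ = cong suc (size-+ {a} {b} (λ x → P? (suc x)))
... | no  _ = size-+ {a} {b} (λ x → P? (suc x))

size-bijection : ∀ {a b} {P : Fin a → Set} {Q : Fin b → Set} (P? : Decidable P) (Q? : Decidable Q)
                 (g : Fin a → Fin b) → (∀ x → P x → Q (g x)) →
                 (∀ x x' → P x → P x' → g x ≡ g x' → x ≡ x') →
                 (∀ y → Q y → Σ (Fin a) λ x → P x × g x ≡ y) → size P? ≡ size Q?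
size-bijection {zero} P? Q? g maps inj surj = sym (size-empty Q? (λ y qy → ¬Fin0 (proj₁ (surj y qy))))
size-bijection {suc a} {b} {P} {Q} P? Q? g maps inj surj with P? zero
... | yes p0 = trans (cong suc rest) (sym Q-size)
  where
  Q?′ : Decidable (λ y → Q y × ¬ y ≡ g zero)
  Q?′ y = Q? y ×-dec ¬? (y ≟ g zero)
  rest : size (λ x → P? (suc x)) ≡ size Q?′
  rest = size-bijection _ Q?′ (λ x → g (suc x))
           (λ x px → maps (suc x) px , λ e → 0≢1+n (sym (inj (suc x) zero px p0 e)))
           (λ x x' px px' e → suc-injective (inj (suc x) (suc x') px px' e))
           surj′
    where
    surj′ : ∀ y → Q y × ¬ y ≡ g zero → Σ (Fin a) λ x → P (suc x) × g (suc x) ≡ y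
    surj′ y (qy , y≢g0) with surj y qy
    ... | zero  , _  , e = ⊥-elim (y≢g0 (sym e))
    ... | suc x , px , e = x , px , e
  Q-size : size Q? ≡ suc (size Q?′)
  Q-size rewrite size-partition Q? (_≟ g zero)
               | size-singleton (λ y → Q? y ×-dec (y ≟ g zero)) (g zero) (maps zero p0 , refl) (λ _ → proj₂) = refl
... | no ¬p0 = size-bijection _ Q? (λ x → g (suc x)) (λ x → maps (suc x))
                 (λ x x' px px' e → suc-injective (inj (suc x) (suc x') px px' e)) surj′
  where
  surj′ : ∀ y → Q y → Σ (Fin a) λ x → P (suc x) × g (suc x) ≡ y
  surj′ y qy with surj y qy
  ... | zero  , p0 , _ = ⊥-elim (¬p0 p0)
  ... | suc x , px , e = x , px , e

length-filter-tabulate : ∀ {n m} {P : Fin m → Set} (P? : Decidable P) (g : Fin n → Fin m) →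
                         List.length (List.filter P? (List.tabulate g)) ≡ size (λ x → P? (g x))
length-filter-tabulate {zero}  P? g = refl
length-filter-tabulate {suc n} P? g with P? (g zero)
... | yes _ = cong suc (length-filter-tabulate P? (λ x → g (suc x)))
... | no  _ = length-filter-tabulate P? (λ x → g (suc x))

module _ (C : Config) where

  Between : Fin (n C) → Fin (n C) → Fin (r C) → Fin (r C) → Fin (n C) → Set
  Between u v R S w = w ∈ pts C × col C u w ≡ R × col C w v ≡ S

  between? : ∀ u v R S → Decidable (Between u v R S)
  between? u v R S w = (w ∈? pts C) ×-dec ((col C u w ≟ R) ×-dec (col C w v ≟ S))

  count≡size : ∀ u v R S → count C u v R S ≡ size (between? u v R S)
  count≡size u v R S = length-filter-tabulate (between? u v R S) id

  count-positive : ∀ {u v R S} w → Between u v R S w → 1 ≤ count C u v R S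
  count-positive {u} {v} {R} {S} w bw =
    subst (1 ≤_) (sym (count≡size u v R S)) (size-positive (between? u v R S) w bw)

  opaque
    count-witness : ∀ {u v R S} → 1 ≤ count C u v R S → Σ (Fin (n C)) (Between u v R S)
    count-witness {u} {v} {R} {S} pos = size-witness (between? u v R S) (subst (1 ≤_) (count≡size u v R S) pos)

  count≡1 : ∀ {u v R S} a → Between u v R S a → (∀ b → Between u v R S b → b ≡ a) → count C u v R S ≡ 1
  count≡1 {u} {v} {R} {S} a ba unique = trans (count≡size u v R S) (size-singleton (between? u v R S) a ba unique)

  count≡1⇒unique : ∀ {u v R S} → count C u v R S ≡ 1 → ∀ a b → Between u v R S a → Between u v R S b → a ≡ b
  count≡1⇒unique {u} {v} {R} {S} count≡1 =
    size≡1⇒unique (between? u v R S) (trans (sym (count≡size u v R S)) count≡1)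

used : ∀ (C : Config) {u v} → u ∈ pts C → v ∈ pts C → Used C (col C u v)
used C {u} {v} pu pv = u , v , pu , pv , refl

module CoherentProperties (C : Config) (cc : IsCC C) where
  open IsCC cc

  src-fiber-cong : ∀ {u v a b} → u ∈ pts C → v ∈ pts C → a ∈ pts C → b ∈ pts C →
                   col C u v ≡ col C a b → col C u u ≡ col C a a
  src-fiber-cong {u} {v} {a} {b} pu pv pa pb e
    with count-witness C (subst (1 ≤_) (regular u v a b pu pv pa pb e (col C u u) (col C u v))
                                        (count-positive C u (pu , refl , refl)))
  ... | w , pw , aw , wb = trans (sym aw) (cong (col C a) (sym (loops u a w pu pa pw (sym aw))))

  tgt-fiber-cong : ∀ {u v a b} → u ∈ pts C → v ∈ pts C → a ∈ pts C → b ∈ pts C →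
                   col C u v ≡ col C a b → col C v v ≡ col C b b
  tgt-fiber-cong {u} {v} {a} {b} pu pv pa pb e
    with count-witness C (subst (1 ≤_) (regular u v a b pu pv pa pb e (col C u v) (col C v v))
                                        (count-positive C v (pv , refl , refl)))
  ... | w , pw , aw , wb = trans (sym wb) (cong (λ z → col C z b) (loops v w b pv pw pb (sym wb)))

module AlgIsoProperties (C D : Config) (ccC : IsCC C) (ccD : IsCC D) (iso : AlgIso C D) where
  open AlgIso iso
  private
    module C = IsCC ccC
    module D = IsCC ccD

  numbers : ∀ {u v a b} → u ∈ pts C → v ∈ pts C → a ∈ pts D → b ∈ pts D → col D a b ≡ f (col C u v) →
            ∀ {R S} → Used C R → Used C S → count D a b (f R) (f S) ≡ count C u v R S
  numbers pu pv pa pb e {R} {S} uR uS = f-numbers R S uR uS _ _ _ _ pu pv pa pb e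

  f-injective : ∀ {u v u' v'} → u ∈ pts C → v ∈ pts C → u' ∈ pts C → v' ∈ pts C →
                f (col C u v) ≡ f (col C u' v') → col C u v ≡ col C u' v'
  f-injective pu pv pu' pv' = f-inj _ _ (used C pu pv) (used C pu' pv')

  f-loop-injective : ∀ {c u} → IsFiber C c → u ∈ pts C → f (col C u u) ≡ f c → col C u u ≡ c
  f-loop-injective (x , px , xx≡c) pu fuu≡fc = trans (f-injective pu pu px px (trans fuu≡fc (cong f (sym xx≡c)))) xx≡c

  witness-in-C : ∀ {u v a b} → u ∈ pts C → v ∈ pts C → a ∈ pts D → b ∈ pts D → col D a b ≡ f (col C u v) →
                 ∀ {R S} → Used C R → Used C S → 1 ≤ count D a b (f R) (f S) → Σ (Fin (n C)) (Between C u v R S)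
  witness-in-C pu pv pa pb e uR uS pos = count-witness C (subst (1 ≤_) (numbers pu pv pa pb e uR uS) pos)

  witness-in-D : ∀ {u v a b} → u ∈ pts C → v ∈ pts C → a ∈ pts D → b ∈ pts D → col D a b ≡ f (col C u v) →
                 ∀ {R S} → Used C R → Used C S → 1 ≤ count C u v R S → Σ (Fin (n D)) (Between D a b (f R) (f S))
  witness-in-D pu pv pa pb e uR uS pos = count-witness D (subst (1 ≤_) (sym (numbers pu pv pa pb e uR uS)) pos)

  image-of-loop⇒diagonal : ∀ {x a b} → x ∈ pts C → a ∈ pts D → b ∈ pts D → col D a b ≡ f (col C x x) → a ≡ b
  image-of-loop⇒diagonal {x} {a} {b} px pa pb e with f-surj (col D a a) (used D pa pa)
  ... | s , us , fs with witness-in-C px px pa pb e us (used C px px) (count-positive D a (pa , sym fs , e))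
  ...   | w , pw , xw≡s , wx≡xx = D.loops a a b pa pa pb (trans (sym fs) (trans (cong f s≡xx) (sym e)))
    where
    s≡xx : s ≡ col C x x
    s≡xx = trans (sym xw≡s) (cong (col C x) (C.loops x w x px pw px (sym wx≡xx)))

  src-loop-image : ∀ {u v a b} → u ∈ pts C → v ∈ pts C → a ∈ pts D → b ∈ pts D →
                   col D a b ≡ f (col C u v) → col D a a ≡ f (col C u u)
  src-loop-image {u} {v} pu pv pa pb e
    with witness-in-D pu pv pa pb e (used C pu pu) (used C pu pv) (count-positive C u (pu , refl , refl))
  ... | w , pw , aw , _ = trans (cong (col D _) (image-of-loop⇒diagonal pu pa pw aw)) aw

  tgt-loop-image : ∀ {u v a b} → u ∈ pts C → v ∈ pts C → a ∈ pts D → b ∈ pts D →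
                   col D a b ≡ f (col C u v) → col D b b ≡ f (col C v v)
  tgt-loop-image {u} {v} pu pv pa pb e
    with witness-in-D pu pv pa pb e (used C pu pv) (used C pv pv) (count-positive C v (pv , refl , refl))
  ... | w , pw , _ , wb = trans (cong (λ z → col D z _) (sym (image-of-loop⇒diagonal pv pw pb wb))) wb

  transpose-image : ∀ {u v a b} → u ∈ pts C → v ∈ pts C → a ∈ pts D → b ∈ pts D →
                    col D a b ≡ f (col C u v) → col D b a ≡ f (col C v u)
  transpose-image {u} {v} {a} {b} pu pv pa pb e with f-surj (col D b a) (used D pb pa)
  ... | t , ut , ft
    with witness-in-C pu pu pa pa (src-loop-image pu pv pa pb e) (used C pu pv) ut (count-positive D b (pb , e , sym ft))
  ...   | w , pw , uw≡uv , wu≡t = trans (sym ft) (cong f (trans (sym wu≡t) (C.transpose u w u v pu pw pu pv uw≡uv)))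

does≡true⇒ : ∀ {A : Set} (A? : Dec A) → does A? ≡ true → A
does≡true⇒ (yes a) _ = a

∈tabulate⁺ : ∀ {m} (g : Fin m → Bool) x → g x ≡ true → x ∈ tabulate g
∈tabulate⁺ g x gx = lookup⇒[]= x (tabulate g) (trans (lookup∘tabulate g x) gx)

∈tabulate⁻ : ∀ {m} (g : Fin m → Bool) x → x ∈ tabulate g → g x ≡ true
∈tabulate⁻ g x x∈ = trans (sym (lookup∘tabulate g x)) ([]=⇒lookup x∈)

used? : ∀ (C : Config) k → Dec (Used C k)
used? C k = any? (λ u → any? (λ v → (u ∈? pts C) ×-dec ((v ∈? pts C) ×-dec (col C u v ≟ k))))

by-fiber : ∀ (C : Config) (i : Fin (r C)) {A : Set} x → (col C x x ≡ i → A) → (col C x x ≢ i → A) → A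
by-fiber C i x inside outside = [ inside , outside ]′ (toSum (col C x x ≟ i))

module _ (C : Config) (i : Fin (r C)) where

  inFiber? : Decidable (InFiber C i)
  inFiber? x = (x ∈? pts C) ×-dec (col C x x ≟ i)

  ∈fiberSet⁺ : ∀ {x} → x ∈ pts C → col C x x ≡ i → x ∈ fiberSet C i
  ∈fiberSet⁺ {x} px e = x∈p∩q⁺ (px , ∈tabulate⁺ _ x (dec-true (col C x x ≟ i) e))

  ∈fiberSet⁻ : ∀ {x} → x ∈ fiberSet C i → col C x x ≡ i
  ∈fiberSet⁻ {x} x∈ = does≡true⇒ (col C x x ≟ i) (∈tabulate⁻ _ x (proj₂ (x∈p∩q⁻ (pts C) _ x∈)))

  ∈removeFiber⁺ : ∀ {x} → x ∈ pts C → col C x x ≢ i → x ∈ pts (removeFiber C i)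
  ∈removeFiber⁺ px x∉X = x∈p∩q⁺ (px , x∉p⇒x∈∁p (λ x∈X → x∉X (∈fiberSet⁻ x∈X)))

  ∈removeFiber⁻ : ∀ {x} → x ∈ pts (removeFiber C i) → x ∈ pts C × col C x x ≢ i
  ∈removeFiber⁻ x∈ with x∈p∩q⁻ (pts C) _ x∈
  ... | px , x∈∁X = px , λ e → x∈∁p⇒x∉p x∈∁X (∈fiberSet⁺ px e)

  ∈removeFiber⇒∈ : ∀ {x} → x ∈ pts (removeFiber C i) → x ∈ pts C
  ∈removeFiber⇒∈ x∈ = proj₁ (∈removeFiber⁻ x∈)

  used-removeFiber⇒used : ∀ {k} → Used (removeFiber C i) k → Used C k
  used-removeFiber⇒used (u , v , pu , pv , e) = u , v , ∈removeFiber⇒∈ pu , ∈removeFiber⇒∈ pv , e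

module CountsThroughFiber (C : Config) (cc : IsCC C) (i : Fin (r C)) where
  open CoherentProperties C cc

  Through : Fin (n C) → Fin (n C) → Fin (r C) → Fin (r C) → Fin (n C) → Set
  Through u v R S w = InFiber C i w × col C u w ≡ R × col C w v ≡ S

  through? : ∀ u v R S → Decidable (Through u v R S)
  through? u v R S w = inFiber? C i w ×-dec ((col C u w ≟ R) ×-dec (col C w v ≟ S))

  countThrough : Fin (n C) → Fin (n C) → Fin (r C) → Fin (r C) → ℕ
  countThrough u v R S = size (through? u v R S)

  -- Every pair of colour R = col C c d ends in the fiber of d.
  module _ {u c d : Fin (n C)} {R : Fin (r C)} (pu : u ∈ pts C) (pc : c ∈ pts C) (pd : d ∈ pts C)
           (cd≡R : col C c d ≡ R) {v : Fin (n C)} {S : Fin (r C)} where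

    private
      target-fiber : ∀ {w} → w ∈ pts C → col C u w ≡ R → col C w w ≡ col C d d
      target-fiber pw uw≡R = tgt-fiber-cong pu pw pc pd (trans uw≡R (sym cd≡R))

    countThrough≡count : col C d d ≡ i → countThrough u v R S ≡ count C u v R S
    countThrough≡count dd≡i = trans
      (size-cong (through? u v R S) (between? C u v R S)
        (λ w ((pw , _) , rest) → pw , rest)
        (λ w (pw , uw≡R , wv≡S) → (pw , trans (target-fiber pw uw≡R) dd≡i) , uw≡R , wv≡S))
      (sym (count≡size C u v R S))

    countThrough≡0 : col C d d ≢ i → countThrough u v R S ≡ 0
    countThrough≡0 dd≢i = size-empty (through? u v R S)
      (λ w ((pw , ww≡i) , uw≡R , _) → dd≢i (trans (sym (target-fiber pw uw≡R)) ww≡i))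

    count-removeFiber≡count : col C d d ≢ i → count (removeFiber C i) u v R S ≡ count C u v R S
    count-removeFiber≡count dd≢i = trans (count≡size (removeFiber C i) u v R S) (trans
      (size-cong (between? (removeFiber C i) u v R S) (between? C u v R S)
        (λ w (pw , rest) → ∈removeFiber⇒∈ C i pw , rest)
        (λ w (pw , uw≡R , wv≡S) →
          ∈removeFiber⁺ C i pw (λ ww≡i → dd≢i (trans (sym (target-fiber pw uw≡R)) ww≡i)) , uw≡R , wv≡S))
      (sym (count≡size C u v R S)))

    count-removeFiber≡0 : col C d d ≡ i → count (removeFiber C i) u v R S ≡ 0
    count-removeFiber≡0 dd≡i = trans (count≡size (removeFiber C i) u v R S)
      (size-empty (between? (removeFiber C i) u v R S)
        (λ w (pw , uw≡R , _) →
          proj₂ (∈removeFiber⁻ C i pw) (trans (target-fiber (∈removeFiber⇒∈ C i pw) uw≡R) dd≡i)))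

  private
    unused⇒countThrough≡0 : ∀ {u v R S} → u ∈ pts C → ¬ Used C R → countThrough u v R S ≡ 0
    unused⇒countThrough≡0 {u} {v} {R} {S} pu R-unused =
      size-empty (through? u v R S) (λ w ((pw , _) , uw≡R , _) → R-unused (u , w , pu , pw , uw≡R))

    unused⇒count-removeFiber≡0 : ∀ {u v R S} → u ∈ pts C → ¬ Used C R → count (removeFiber C i) u v R S ≡ 0
    unused⇒count-removeFiber≡0 {u} {v} {R} {S} pu R-unused = trans (count≡size (removeFiber C i) u v R S)
      (size-empty (between? (removeFiber C i) u v R S)
        (λ w (pw , uw≡R , _) → R-unused (u , w , pu , ∈removeFiber⇒∈ C i pw , uw≡R)))

  countThrough-regular : ∀ {u v u' v'} → u ∈ pts C → v ∈ pts C → u' ∈ pts C → v' ∈ pts C →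
                         col C u v ≡ col C u' v' → ∀ R S → countThrough u v R S ≡ countThrough u' v' R S
  countThrough-regular {u} {v} {u'} {v'} pu pv pu' pv' e R S with used? C R
  ... | no R-unused = trans (unused⇒countThrough≡0 pu R-unused) (sym (unused⇒countThrough≡0 pu' R-unused))
  ... | yes (c , d , pc , pd , cd≡R) with col C d d ≟ i
  ...   | yes dd≡i = trans (countThrough≡count pu pc pd cd≡R dd≡i)
                       (trans (IsCC.regular cc u v u' v' pu pv pu' pv' e R S)
                         (sym (countThrough≡count pu' pc pd cd≡R dd≡i)))
  ...   | no  dd≢i = trans (countThrough≡0 pu pc pd cd≡R dd≢i) (sym (countThrough≡0 pu' pc pd cd≡R dd≢i))

  removeFiber-isCC : IsCC (removeFiber C i)
  removeFiber-isCC = record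
    { loops     = λ u v w pu pv pw → IsCC.loops cc u v w (fromR pu) (fromR pv) (fromR pw)
    ; transpose = λ u v u' v' pu pv pu' pv' → IsCC.transpose cc u v u' v' (fromR pu) (fromR pv) (fromR pu') (fromR pv')
    ; regular   = regular }
    where
    fromR : ∀ {x} → x ∈ pts (removeFiber C i) → x ∈ pts C
    fromR = ∈removeFiber⇒∈ C i
    regular : ∀ u v u' v' → u ∈ pts (removeFiber C i) → v ∈ pts (removeFiber C i) →
              u' ∈ pts (removeFiber C i) → v' ∈ pts (removeFiber C i) → col C u v ≡ col C u' v' →
              ∀ R S → count (removeFiber C i) u v R S ≡ count (removeFiber C i) u' v' R S
    regular u v u' v' pu pv pu' pv' e R S with used? C R
    ... | no R-unused = trans (unused⇒count-removeFiber≡0 (fromR pu) R-unused)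
                          (sym (unused⇒count-removeFiber≡0 (fromR pu') R-unused))
    ... | yes (c , d , pc , pd , cd≡R) with col C d d ≟ i
    ...   | yes dd≡i = trans (count-removeFiber≡0 (fromR pu) pc pd cd≡R dd≡i)
                         (sym (count-removeFiber≡0 (fromR pu') pc pd cd≡R dd≡i))
    ...   | no  dd≢i = trans (count-removeFiber≡count (fromR pu) pc pd cd≡R dd≢i)
                         (trans (IsCC.regular cc u v u' v' (fromR pu) (fromR pv) (fromR pu') (fromR pv') e R S)
                           (sym (count-removeFiber≡count (fromR pu') pc pd cd≡R dd≢i)))

module Matching {C : Config} {i j : Fin (r C)} (matching : HasMatching C i j) where

  k : Fin (r C)
  k = proj₁ matching

  matching-ends : ∀ {u v} → u ∈ pts C → v ∈ pts C → col C u v ≡ k → InFiber C i u × InFiber C j v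
  matching-ends = proj₁ (proj₂ (proj₂ matching)) _ _

  partner : ∀ {x} → InFiber C i x → Fin (n C)
  partner x∈X = proj₁ (proj₁ (proj₂ (proj₂ (proj₂ matching))) _ x∈X)

  partner-pts : ∀ {x} (x∈X : InFiber C i x) → partner x∈X ∈ pts C
  partner-pts x∈X = proj₁ (proj₁ (proj₂ (proj₁ (proj₂ (proj₂ (proj₂ matching))) _ x∈X)))

  partner-col : ∀ {x} (x∈X : InFiber C i x) → col C x (partner x∈X) ≡ k
  partner-col x∈X = proj₂ (proj₁ (proj₂ (proj₁ (proj₂ (proj₂ (proj₂ matching))) _ x∈X)))

  partner-unique : ∀ {x} (x∈X : InFiber C i x) → ∀ {y} → y ∈ pts C → col C x y ≡ k → y ≡ partner x∈X
  partner-unique x∈X py = proj₂ (proj₂ (proj₁ (proj₂ (proj₂ (proj₂ matching))) _ x∈X)) _ py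

  partner-fiber : ∀ {x} (x∈X : InFiber C i x) → InFiber C j (partner x∈X)
  partner-fiber x∈X = proj₂ (matching-ends (proj₁ x∈X) (partner-pts x∈X) (partner-col x∈X))

  copartner : ∀ {y} → InFiber C j y → Fin (n C)
  copartner y∈Y = proj₁ (proj₂ (proj₂ (proj₂ (proj₂ matching))) _ y∈Y)

  copartner-pts : ∀ {y} (y∈Y : InFiber C j y) → copartner y∈Y ∈ pts C
  copartner-pts y∈Y = proj₁ (proj₁ (proj₂ (proj₂ (proj₂ (proj₂ (proj₂ matching))) _ y∈Y)))

  copartner-col : ∀ {y} (y∈Y : InFiber C j y) → col C (copartner y∈Y) y ≡ k
  copartner-col y∈Y = proj₂ (proj₁ (proj₂ (proj₂ (proj₂ (proj₂ (proj₂ matching))) _ y∈Y)))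

  copartner-unique : ∀ {y} (y∈Y : InFiber C j y) → ∀ {x} → x ∈ pts C → col C x y ≡ k → x ≡ copartner y∈Y
  copartner-unique y∈Y px = proj₂ (proj₂ (proj₂ (proj₂ (proj₂ (proj₂ matching))) _ y∈Y)) _ px

  copartner-fiber : ∀ {y} (y∈Y : InFiber C j y) → InFiber C i (copartner y∈Y)
  copartner-fiber y∈Y = proj₁ (matching-ends (copartner-pts y∈Y) (proj₁ y∈Y) (copartner-col y∈Y))

module RestrictedIso (C D : Config) (ccC : IsCC C) (ccD : IsCC D) (iso : AlgIso C D)
                     (i : Fin (r C)) (i-fiber : IsFiber C i) where
  open AlgIso iso
  open AlgIsoProperties C D ccC ccD iso

  Cᵢ : Config
  Cᵢ = removeFiber C i

  Dᵢ : Config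
  Dᵢ = removeFiber D (f i)

  outside-image : ∀ {u a} → u ∈ pts C → col D a a ≡ f (col C u u) → col C u u ≢ i → col D a a ≢ f i
  outside-image pu aa≡fuu uu≢i aa≡fi = uu≢i (f-loop-injective i-fiber pu (trans (sym aa≡fuu) aa≡fi))

  outside-preimage : ∀ {u a} → col D a a ≡ f (col C u u) → col D a a ≢ f i → col C u u ≢ i
  outside-preimage aa≡fuu aa≢fi uu≡i = aa≢fi (trans aa≡fuu (cong f uu≡i))

  restrict-used : ∀ t → Used Cᵢ t → Used Dᵢ (f t)
  restrict-used t (u , v , pu , pv , uv≡t) with ∈removeFiber⁻ C i pu | ∈removeFiber⁻ C i pv
  ... | pu₀ , uu≢i | pv₀ , vv≢i with f-used t (u , v , pu₀ , pv₀ , uv≡t)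
  ...   | a , b , pa , pb , ab≡ft = a , b , pa′ , pb′ , ab≡ft
    where
    ab≡fuv : col D a b ≡ f (col C u v)
    ab≡fuv = trans ab≡ft (cong f (sym uv≡t))
    pa′ = ∈removeFiber⁺ D (f i) pa (outside-image pu₀ (src-loop-image pu₀ pv₀ pa pb ab≡fuv) uu≢i)
    pb′ = ∈removeFiber⁺ D (f i) pb (outside-image pv₀ (tgt-loop-image pu₀ pv₀ pa pb ab≡fuv) vv≢i)

  restrict-surj : ∀ k' → Used Dᵢ k' → Σ (Fin (r C)) λ t → Used Cᵢ t × f t ≡ k'
  restrict-surj k' (a , b , pa , pb , ab≡k') with ∈removeFiber⁻ D (f i) pa | ∈removeFiber⁻ D (f i) pb
  ... | pa₀ , aa≢fi | pb₀ , bb≢fi with f-surj k' (a , b , pa₀ , pb₀ , ab≡k')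
  ...   | t , (u , v , pu , pv , uv≡t) , ft≡k' = t , (u , v , pu′ , pv′ , uv≡t) , ft≡k'
    where
    ab≡fuv : col D a b ≡ f (col C u v)
    ab≡fuv = trans ab≡k' (trans (sym ft≡k') (cong f (sym uv≡t)))
    pu′ = ∈removeFiber⁺ C i pu (outside-preimage (src-loop-image pu pv pa₀ pb₀ ab≡fuv) aa≢fi)
    pv′ = ∈removeFiber⁺ C i pv (outside-preimage (tgt-loop-image pu pv pa₀ pb₀ ab≡fuv) bb≢fi)

  restrict-numbers : ∀ R S → Used Cᵢ R → Used Cᵢ S → ∀ u v a b → u ∈ pts Cᵢ → v ∈ pts Cᵢ →
                     a ∈ pts Dᵢ → b ∈ pts Dᵢ → col D a b ≡ f (col C u v) →
                     count Dᵢ a b (f R) (f S) ≡ count Cᵢ u v R S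
  restrict-numbers R S uR@(c , d , pc , pd , cd≡R) uS u v a b pu pv pa pb ab≡fuv = begin
    count Dᵢ a b (f R) (f S)
      ≡⟨ CountsThroughFiber.count-removeFiber≡count D ccD (f i) (fromD pa) (fromD pc') (fromD pd') c'd'≡fR
           (proj₂ (∈removeFiber⁻ D (f i) pd')) ⟩
    count D a b (f R) (f S)
      ≡⟨ numbers (fromC pu) (fromC pv) (fromD pa) (fromD pb) ab≡fuv
           (used-removeFiber⇒used C i uR) (used-removeFiber⇒used C i uS) ⟩
    count C u v R S
      ≡⟨ CountsThroughFiber.count-removeFiber≡count C ccC i (fromC pu) (fromC pc) (fromC pd) cd≡R
           (proj₂ (∈removeFiber⁻ C i pd)) ⟨
    count Cᵢ u v R S ∎
    where
    open ≡-Reasoning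
    fromC : ∀ {x} → x ∈ pts Cᵢ → x ∈ pts C
    fromC = ∈removeFiber⇒∈ C i
    fromD : ∀ {x} → x ∈ pts Dᵢ → x ∈ pts D
    fromD = ∈removeFiber⇒∈ D (f i)
    imageR : Used Dᵢ (f R)
    imageR = restrict-used R uR
    c' = proj₁ imageR
    d' = proj₁ (proj₂ imageR)
    pc' : c' ∈ pts Dᵢ
    pc' = proj₁ (proj₂ (proj₂ imageR))
    pd' : d' ∈ pts Dᵢ
    pd' = proj₁ (proj₂ (proj₂ (proj₂ imageR)))
    c'd'≡fR : col D c' d' ≡ f R
    c'd'≡fR = proj₂ (proj₂ (proj₂ (proj₂ imageR)))

  restrictedIso : AlgIso Cᵢ Dᵢ
  restrictedIso = record
    { f         = f
    ; f-used    = restrict-used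
    ; f-inj     = λ t t' ut ut' → f-inj t t' (used-removeFiber⇒used C i ut) (used-removeFiber⇒used C i ut')
    ; f-surj    = restrict-surj
    ; f-numbers = restrict-numbers }

module CountThroughImage (E E' : Config) (ccE : IsCC E) (ccE' : IsCC E') (iso : AlgIso E E')
                         (j : Fin (r E)) (j-fiber : IsFiber E j) where
  open AlgIso iso
  open AlgIsoProperties E E' ccE ccE' iso
  open CountsThroughFiber E ccE j using (countThrough; countThrough≡count; countThrough≡0)
  open CountsThroughFiber E' ccE' (f j) using ()
    renaming (countThrough to countThrough′; countThrough≡count to countThrough≡count′; countThrough≡0 to countThrough≡0′)

  countThrough-image : ∀ {a b a' b'} → a ∈ pts E → b ∈ pts E → a' ∈ pts E' → b' ∈ pts E' →
                       col E' a' b' ≡ f (col E a b) → ∀ {R S} → Used E R → Used E S →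
                       countThrough′ a' b' (f R) (f S) ≡ countThrough a b R S
  countThrough-image {a} {b} {a'} {b'} pa pb pa' pb' a'b'≡ {R} {S} uR@(c , d , pc , pd , cd≡R) uS =
    by-target-fiber (col E d d ≟ j)
    where
    image = f-used R uR
    c' = proj₁ image
    d' = proj₁ (proj₂ image)
    pc' : c' ∈ pts E'
    pc' = proj₁ (proj₂ (proj₂ image))
    pd' : d' ∈ pts E'
    pd' = proj₁ (proj₂ (proj₂ (proj₂ image)))
    c'd'≡fR : col E' c' d' ≡ f R
    c'd'≡fR = proj₂ (proj₂ (proj₂ (proj₂ image)))
    d'd'≡ : col E' d' d' ≡ f (col E d d)
    d'd'≡ = tgt-loop-image pc pd pc' pd' (trans c'd'≡fR (cong f (sym cd≡R)))
    by-target-fiber : Dec (col E d d ≡ j) → countThrough′ a' b' (f R) (f S) ≡ countThrough a b R S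
    by-target-fiber (yes dd≡j) = begin
      countThrough′ a' b' (f R) (f S) ≡⟨ countThrough≡count′ pa' pc' pd' c'd'≡fR (trans d'd'≡ (cong f dd≡j)) ⟩
      count E' a' b' (f R) (f S)      ≡⟨ numbers pa pb pa' pb' a'b'≡ uR uS ⟩
      count E a b R S                 ≡⟨ countThrough≡count pa pc pd cd≡R dd≡j ⟨
      countThrough a b R S            ∎
      where open ≡-Reasoning
    by-target-fiber (no dd≢j) =
      trans (countThrough≡0′ pa' pc' pd' c'd'≡fR d'd'≢fj) (sym (countThrough≡0 pa pc pd cd≡R dd≢j))
      where
      d'd'≢fj : col E' d' d' ≢ f j
      d'd'≢fj d'd'≡fj = dd≢j (f-loop-injective j-fiber pd (trans (sym d'd'≡) d'd'≡fj))

module MatchingImage (C D : Config) (ccC : IsCC C) (ccD : IsCC D) (iso : AlgIso C D)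
                     {i j : Fin (r C)} (i-fiber : IsFiber C i) (j-fiber : IsFiber C j)
                     (matching : HasMatching C i j) where
  open AlgIso iso
  open AlgIsoProperties C D ccC ccD iso
  open Matching matching

  private
    x₀ = proj₁ i-fiber
    x₀∈X : InFiber C i x₀
    x₀∈X = proj₂ i-fiber
    px₀ = proj₁ x₀∈X
    y₀ = proj₁ j-fiber
    y₀∈Y : InFiber C j y₀
    y₀∈Y = proj₂ j-fiber
    py₀ = proj₁ y₀∈Y

    loop-image : ∀ {c a} → InFiber C c a → ∀ {a'} → col D a' a' ≡ f c → col D a' a' ≡ f (col C a a)
    loop-image (_ , aa≡c) a'a'≡fc = trans a'a'≡fc (cong f (sym aa≡c))

  image-partner : ∀ {x'} → InFiber D (f i) x' → Σ (Fin (n D)) λ y' → y' ∈ pts D × col D x' y' ≡ f k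
  image-partner (px' , x'x'≡fi)
    with witness-in-D px₀ px₀ px' px' (loop-image x₀∈X x'x'≡fi)
           (used C px₀ (partner-pts x₀∈X)) (used C (partner-pts x₀∈X) px₀)
           (count-positive C _ (partner-pts x₀∈X , refl , refl))
  ... | y' , py' , x'y'≡ , _ = y' , py' , trans x'y'≡ (cong f (partner-col x₀∈X))

  image-partner-fiber : ∀ {x' y'} → InFiber D (f i) x' → y' ∈ pts D → col D x' y' ≡ f k → InFiber D (f j) y'
  image-partner-fiber {x'} {y'} (px' , _) py' x'y'≡fk =
    py' , trans (tgt-loop-image px₀ (partner-pts x₀∈X) px' py'
                  (trans x'y'≡fk (cong f (sym (partner-col x₀∈X)))))
                (cong f (proj₂ (partner-fiber x₀∈X)))

  private
    x₁ = copartner y₀∈Y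
    px₁ = copartner-pts y₀∈Y

    copartner-count : count C y₀ y₀ (col C y₀ x₁) (col C x₁ y₀) ≡ 1
    copartner-count = count≡1 C x₁ (px₁ , refl , refl)
      (λ b (pb , _ , by₀≡) → trans (copartner-unique y₀∈Y pb (trans by₀≡ (copartner-col y₀∈Y)))
                                   (sym (copartner-unique y₀∈Y px₁ (copartner-col y₀∈Y))))

  module _ {y'} (y'∈Y' : InFiber D (f j) y') where
    private
      y'y'≡ = loop-image y₀∈Y (proj₂ y'∈Y')
      py' = proj₁ y'∈Y'

    image-copartner : Σ (Fin (n D)) λ x' → x' ∈ pts D × col D x' y' ≡ f k
    image-copartner
      with witness-in-D py₀ py₀ py' py' y'y'≡ (used C py₀ px₁) (used C px₁ py₀)
             (count-positive C x₁ (px₁ , refl , refl))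
    ... | x' , px' , _ , x'y'≡ = x' , px' , trans x'y'≡ (cong f (copartner-col y₀∈Y))

    image-copartner-unique : ∀ {a b} → a ∈ pts D → b ∈ pts D → col D a y' ≡ f k → col D b y' ≡ f k → a ≡ b
    image-copartner-unique {a} {b} pa pb ay'≡fk by'≡fk =
      count≡1⇒unique D count′≡1 a b
        (pa , transpose-image px₁ py₀ pa py' ay'≡ , ay'≡)
        (pb , transpose-image px₁ py₀ pb py' by'≡ , by'≡)
      where
      count′≡1 : count D y' y' (f (col C y₀ x₁)) (f (col C x₁ y₀)) ≡ 1
      count′≡1 = trans (numbers py₀ py₀ py' py' y'y'≡
                          (used C py₀ px₁) (used C px₁ py₀))
                       copartner-count
      ay'≡ = trans ay'≡fk (cong f (sym (copartner-col y₀∈Y)))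
      by'≡ = trans by'≡fk (cong f (sym (copartner-col y₀∈Y)))

module ExtendAlongMatching (C D : Config) (ccC : IsCC C) (ccD : IsCC D) (iso : AlgIso C D)
                           {i j : Fin (r C)} (i-fiber : IsFiber C i) (j-fiber : IsFiber C j) (i≢j : i ≢ j)
                           (matching : HasMatching C i j)
                           (induced : Induces (removeFiber C i) (removeFiber D (AlgIso.f iso i))
                                              (RestrictedIso.restrictedIso C D ccC ccD iso i i-fiber))
                           where
  open AlgIso iso
  open AlgIsoProperties C D ccC ccD iso
  open Matching matching
  open MatchingImage C D ccC ccD iso i-fiber j-fiber matching
  open Induces induced

  private
    Y⊆Cᵢ : ∀ {y} → InFiber C j y → y ∈ pts (removeFiber C i)
    Y⊆Cᵢ (py , yy≡j) = ∈removeFiber⁺ C i py (λ yy≡i → i≢j (trans (sym yy≡i) yy≡j))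

    fi≢fj : f i ≢ f j
    fi≢fj fi≡fj = let y₀ , py₀ , y₀y₀≡j = j-fiber in
      i≢j (trans (sym (f-loop-injective i-fiber py₀ (trans (cong f y₀y₀≡j) (sym fi≡fj)))) y₀y₀≡j)

  partner∉X : ∀ {u} (u∈X : InFiber C i u) → col C (partner u∈X) (partner u∈X) ≢ i
  partner∉X u∈X yy≡i = i≢j (trans (sym yy≡i) (proj₂ (partner-fiber u∈X)))

  φ-Y : ∀ {y} → InFiber C j y → InFiber D (f j) (φ y)
  φ-Y y∈Y@(_ , yy≡j) =
    ∈removeFiber⇒∈ D (f i) (φ-pts _ (Y⊆Cᵢ y∈Y)) , trans (φ-col _ _ (Y⊆Cᵢ y∈Y) (Y⊆Cᵢ y∈Y)) (cong f yy≡j)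

  Φ′ : ∀ u → Dec (InFiber C i u) → Fin (n D)
  Φ′ u (yes u∈X) = proj₁ (image-copartner (φ-Y (partner-fiber u∈X)))
  Φ′ u (no  _)   = φ u

  Φ : Fin (n C) → Fin (n D)
  Φ u = Φ′ u (inFiber? C i u)

  Φ-outside : ∀ {u} → u ∈ pts C → col C u u ≢ i → Φ u ≡ φ u
  Φ-outside {u} pu uu≢i with inFiber? C i u
  ... | yes (_ , uu≡i) = ⊥-elim (uu≢i uu≡i)
  ... | no  _          = refl

  Φ-inside : ∀ {u} → InFiber C i u → ∀ {y} → y ∈ pts C → col C u y ≡ k →
             Φ u ∈ pts D × col D (Φ u) (φ y) ≡ f k
  Φ-inside {u} u∈X {y} py uy≡k with inFiber? C i u
  ... | no  u∉X  = ⊥-elim (u∉X u∈X)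
  ... | yes u∈X′ =
    proj₁ (proj₂ x') ,
    subst (λ z → col D (proj₁ x') (φ z) ≡ f k) (sym (partner-unique u∈X′ py uy≡k)) (proj₂ (proj₂ x'))
    where
    x' = image-copartner (φ-Y (partner-fiber u∈X′))

  Φ-pts : ∀ {u} → u ∈ pts C → Φ u ∈ pts D
  Φ-pts {u} pu = by-fiber C i u
    (λ uu≡i → proj₁ (Φ-inside (pu , uu≡i) (partner-pts (pu , uu≡i)) (partner-col (pu , uu≡i))))
    (λ uu≢i → subst (_∈ pts D) (sym (Φ-outside pu uu≢i))
                (∈removeFiber⇒∈ D (f i) (φ-pts u (∈removeFiber⁺ C i pu uu≢i))))

  Φ-col-outside : ∀ {u v} → u ∈ pts C → v ∈ pts C → col C u u ≢ i → col C v v ≢ i →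
                  col D (Φ u) (Φ v) ≡ f (col C u v)
  Φ-col-outside {u} {v} pu pv uu≢i vv≢i rewrite Φ-outside pu uu≢i | Φ-outside pv vv≢i =
    φ-col u v (∈removeFiber⁺ C i pu uu≢i) (∈removeFiber⁺ C i pv vv≢i)

  module _ {u} (u∈X : InFiber C i u) where
    private
      pu = proj₁ u∈X
      py = partner-pts u∈X
      y∈Y = partner-fiber u∈X
      Φu = Φ-inside u∈X py (partner-col u∈X)
      yy≢i = partner∉X u∈X

    -- The colour of (Φ u, Φ v) is forced by the triangle through φ (partner u).
    Φ-col-via-partner : ∀ {v} → v ∈ pts C → col D (φ (partner u∈X)) (Φ v) ≡ f (col C (partner u∈X) v) →
                        col D (Φ u) (Φ v) ≡ f (col C u v)
    Φ-col-via-partner {v} pv yΦv≡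
      with witness-in-D py pv (proj₁ (φ-Y y∈Y)) (Φ-pts pv) yΦv≡ (used C py pu) (used C pu pv)
             (count-positive C u (pu , refl , refl))
    ... | w , pw , φy-w≡ , wΦv≡ = subst (λ z → col D z (Φ v) ≡ f (col C u v)) w≡Φu wΦv≡
      where
      w≡Φu : w ≡ Φ u
      w≡Φu = image-copartner-unique (φ-Y y∈Y) pw (proj₁ Φu)
               (trans (transpose-image py pu (proj₁ (φ-Y y∈Y)) pw φy-w≡) (cong f (partner-col u∈X)))
               (proj₂ Φu)

    Φ-col-inside-outside : ∀ {v} → v ∈ pts C → col C v v ≢ i → col D (Φ u) (Φ v) ≡ f (col C u v)
    Φ-col-inside-outside pv vv≢i = Φ-col-via-partner pv (subst (λ z → col D z _ ≡ _) (Φ-outside py yy≢i)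
                                     (Φ-col-outside py pv yy≢i vv≢i))

    Φ-col-outside-inside : ∀ {v} → v ∈ pts C → col C v v ≢ i → col D (Φ v) (Φ u) ≡ f (col C v u)
    Φ-col-outside-inside pv vv≢i = transpose-image pu pv (Φ-pts pu) (Φ-pts pv) (Φ-col-inside-outside pv vv≢i)

  Φ-col-inside-inside : ∀ {u v} → InFiber C i u → InFiber C i v → col D (Φ u) (Φ v) ≡ f (col C u v)
  Φ-col-inside-inside u∈X v∈X@(pv , _) = Φ-col-via-partner u∈X pv
    (subst (λ z → col D z _ ≡ _) (Φ-outside (partner-pts u∈X) (partner∉X u∈X))
      (Φ-col-outside-inside v∈X (partner-pts u∈X) (partner∉X u∈X)))

  Φ-col : ∀ u v → u ∈ pts C → v ∈ pts C → col D (Φ u) (Φ v) ≡ f (col C u v)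
  Φ-col u v pu pv = by-fiber C i u
    (λ uu≡i → by-fiber C i v (λ vv≡i → Φ-col-inside-inside (pu , uu≡i) (pv , vv≡i))
                             (Φ-col-inside-outside (pu , uu≡i) pv))
    (λ uu≢i → by-fiber C i v (λ vv≡i → Φ-col-outside-inside (pv , vv≡i) pu uu≢i)
                             (Φ-col-outside pu pv uu≢i))

  Φ-inj : ∀ u v → u ∈ pts C → v ∈ pts C → Φ u ≡ Φ v → u ≡ v
  Φ-inj u v pu pv Φu≡Φv = IsCC.loops ccC u u v pu pu pv (sym (f-injective pu pv pu pu fuv≡fuu))
    where
    fuv≡fuu : f (col C u v) ≡ f (col C u u)
    fuv≡fuu = trans (sym (Φ-col u v pu pv)) (trans (cong (col D (Φ u)) (sym Φu≡Φv)) (Φ-col u u pu pu))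

  Φ-surj-outside : ∀ {u'} → u' ∈ pts D → col D u' u' ≢ f i → Σ (Fin (n C)) λ u → u ∈ pts C × Φ u ≡ u'
  Φ-surj-outside {u'} pu' u'u'≢fi = u , pu₀ , trans (Φ-outside pu₀ (proj₂ (∈removeFiber⁻ C i pu))) φu≡u'
    where
    preimage = φ-surj u' (∈removeFiber⁺ D (f i) pu' u'u'≢fi)
    u = proj₁ preimage
    pu : u ∈ pts (removeFiber C i)
    pu = proj₁ (proj₂ preimage)
    φu≡u' : φ u ≡ u'
    φu≡u' = proj₂ (proj₂ preimage)
    pu₀ = ∈removeFiber⇒∈ C i pu

  -- A point u' of X' is the copartner of its partner y' = φ y, hence the image of the copartner of y.
  Φ-surj-inside : ∀ {u'} → InFiber D (f i) u' → Σ (Fin (n C)) λ u → u ∈ pts C × Φ u ≡ u'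
  Φ-surj-inside {u'} u'∈X'@(pu' , _) =
    x , copartner-pts y∈Y , image-copartner-unique y'∈Y' (proj₁ Φx) pu' Φx-y'≡fk u'y'≡fk
    where
    partner′ = image-partner u'∈X'
    y' = proj₁ partner′
    py' : y' ∈ pts D
    py' = proj₁ (proj₂ partner′)
    u'y'≡fk : col D u' y' ≡ f k
    u'y'≡fk = proj₂ (proj₂ partner′)
    y'∈Y' = image-partner-fiber u'∈X' py' u'y'≡fk
    preimage = φ-surj y' (∈removeFiber⁺ D (f i) py' (λ y'y'≡fi → fi≢fj (trans (sym y'y'≡fi) (proj₂ y'∈Y'))))
    y = proj₁ preimage
    py : y ∈ pts (removeFiber C i)
    py = proj₁ (proj₂ preimage)
    φy≡y' : φ y ≡ y'
    φy≡y' = proj₂ (proj₂ preimage)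
    py₀ = ∈removeFiber⇒∈ C i py
    y∈Y : InFiber C j y
    y∈Y = py₀ , f-loop-injective j-fiber py₀
                  (trans (sym (φ-col y y py py)) (trans (cong₂ (col D) φy≡y' φy≡y') (proj₂ y'∈Y')))
    x = copartner y∈Y
    Φx = Φ-inside (copartner-fiber y∈Y) py₀ (copartner-col y∈Y)
    Φx-y'≡fk : col D (Φ x) y' ≡ f k
    Φx-y'≡fk = subst (λ z → col D (Φ x) z ≡ f k) φy≡y' (proj₂ Φx)

  Φ-surj : ∀ u' → u' ∈ pts D → Σ (Fin (n C)) λ u → u ∈ pts C × Φ u ≡ u'
  Φ-surj u' pu' = by-fiber D (f i) u' (λ u'u'≡fi → Φ-surj-inside (pu' , u'u'≡fi)) (Φ-surj-outside pu')

  extension : Induces C D iso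
  extension = record
    { φ      = Φ
    ; φ-pts  = λ u → Φ-pts
    ; φ-inj  = Φ-inj
    ; φ-surj = Φ-surj
    ; φ-col  = Φ-col }

module Copies (m : ℕ) where

  point : Bool → Fin m → Fin (m + m)
  point false a = a ↑ˡ m
  point true  a = m ↑ʳ a

  side : Fin (m + m) → Bool
  side p = [ (λ _ → false) , (λ _ → true) ]′ (splitAt m p)

  base : Fin (m + m) → Fin m
  base p = [ id , id ]′ (splitAt m p)

  side-point : ∀ s a → side (point s a) ≡ s
  side-point false a rewrite splitAt-↑ˡ m a m = refl
  side-point true  a rewrite splitAt-↑ʳ m m a = refl

  base-point : ∀ s a → base (point s a) ≡ a
  base-point false a rewrite splitAt-↑ˡ m a m = refl
  base-point true  a rewrite splitAt-↑ʳ m m a = refl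

  point-side-base : ∀ p → point (side p) (base p) ≡ p
  point-side-base p with splitAt m p in eq
  ... | inj₁ a = splitAt⁻¹-↑ˡ eq
  ... | inj₂ a = splitAt⁻¹-↑ʳ eq

  point-injective : ∀ {s t a b} → point s a ≡ point t b → s ≡ t × a ≡ b
  point-injective {s} {t} {a} {b} e =
    trans (sym (side-point s a)) (trans (cong side e) (side-point t b)) ,
    trans (sym (base-point s a)) (trans (cong base e) (base-point t b))

  side-base-injective : ∀ {p q} → side p ≡ side q → base p ≡ base q → p ≡ q
  side-base-injective {p} {q} sp≡sq bp≡bq =
    trans (sym (point-side-base p)) (trans (cong₂ point sp≡sq bp≡bq) (point-side-base q))

-- When a middle point on side s may join a point on side x to one on side y through colours
-- tagged with sides (t₁, t₂) and (t₃, t₄).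
Compatible : Bool → Bool → Bool → Bool → Bool → Bool → Bool → Set
Compatible s x y t₁ t₂ t₃ t₄ = x ≡ t₁ × s ≡ t₂ × s ≡ t₃ × y ≡ t₄

compatible? : ∀ s x y t₁ t₂ t₃ t₄ → Dec (Compatible s x y t₁ t₂ t₃ t₄)
compatible? s x y t₁ t₂ t₃ t₄ = (x Bool.≟ t₁) ×-dec ((s Bool.≟ t₂) ×-dec ((s Bool.≟ t₃) ×-dec (y Bool.≟ t₄)))

module Doubling (D : Config) (ccD : IsCC D) (j : Fin (r D)) where
  open CountsThroughFiber D ccD j using (countThrough; countThrough-regular)
  open Copies (n D) public
  private
    module Inner = Copies (r D)
    module Outer = Copies (r D + r D)

  Layer : Bool → Fin (n D) → Set
  Layer false a = a ∈ pts D
  Layer true  a = InFiber D j a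

  layer? : ∀ s → Decidable (Layer s)
  layer? false a = a ∈? pts D
  layer? true  a = inFiber? D j a

  layer⇒pts : ∀ {s a} → Layer s a → a ∈ pts D
  layer⇒pts {false} pa       = pa
  layer⇒pts {true}  (pa , _) = pa

  -- Opaque, so that unification can solve tag s t c ≡ tag s' t' c' argumentwise.
  opaque
    tag : Bool → Bool → Fin (r D) → Fin ((r D + r D) + (r D + r D))
    tag s t c = Outer.point s (Inner.point t c)

    tag-injective : ∀ {s t c s' t' c'} → tag s t c ≡ tag s' t' c' → s ≡ s' × t ≡ t' × c ≡ c'
    tag-injective e with Outer.point-injective e
    ... | s≡s' , e′ with Inner.point-injective e′
    ...   | t≡t' , c≡c' = s≡s' , t≡t' , c≡c'

    tag-surjective : ∀ R → Σ Bool λ s → Σ Bool λ t → Σ (Fin (r D)) λ c → R ≡ tag s t c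
    tag-surjective R = Outer.side R , Inner.side (Outer.base R) , Inner.base (Outer.base R) ,
      sym (trans (cong (Outer.point (Outer.side R)) (Inner.point-side-base (Outer.base R))) (Outer.point-side-base R))

  tag-cong : ∀ {s t c s' t' c'} → s ≡ s' → t ≡ t' → c ≡ c' → tag s t c ≡ tag s' t' c'
  tag-cong refl refl refl = refl

  -- D together with a second copy of its fiber j (the points of side true); a pair is coloured
  -- by the sides of its ends and the colour in D of their base points.
  double : Config
  double = record
    { n   = n D + n D
    ; r   = (r D + r D) + (r D + r D)
    ; pts = tabulate (λ p → does (layer? (side p) (base p)))
    ; col = λ p q → tag (side p) (side q) (col D (base p) (base q)) }

  ∈double⁻ : ∀ {p} → p ∈ pts double → Layer (side p) (base p)
  ∈double⁻ {p} p∈ = does≡true⇒ (layer? (side p) (base p)) (∈tabulate⁻ _ p p∈)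

  ∈double⇒base∈ : ∀ {p} → p ∈ pts double → base p ∈ pts D
  ∈double⇒base∈ p∈ = layer⇒pts (∈double⁻ p∈)

  point∈double : ∀ {s a} → Layer s a → point s a ∈ pts double
  point∈double {s} {a} la =
    ∈tabulate⁺ _ (point s a) (dec-true (layer? _ _) (subst₂ Layer (sym (side-point s a)) (sym (base-point s a)) la))

  point∈double⁻ : ∀ {s a} → point s a ∈ pts double → Layer s a
  point∈double⁻ {s} {a} p∈ = subst₂ Layer (side-point s a) (base-point s a) (∈double⁻ p∈)

  col-to-point : ∀ p s a → col double p (point s a) ≡ tag (side p) s (col D (base p) a)
  col-to-point p s a = cong₂ (λ t b → tag (side p) t (col D (base p) b)) (side-point s a) (base-point s a)

  col-from-point : ∀ q s a → col double (point s a) q ≡ tag s (side q) (col D a (base q))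
  col-from-point q s a = cong₂ (λ t b → tag t (side q) (col D b (base q))) (side-point s a) (base-point s a)

  col-point-point : ∀ s a t b → col double (point s a) (point t b) ≡ tag s t (col D a b)
  col-point-point s a t b = trans (col-to-point (point s a) t b)
    (cong₂ (λ s′ a′ → tag s′ t (col D a′ b)) (side-point s a) (base-point s a))

  slice : Bool → (p q : Fin (n double)) → Fin (r double) → Fin (r double) → ℕ
  slice s p q R S = size (λ a → between? double p q R S (point s a))

  count-double : ∀ p q R S → count double p q R S ≡ slice false p q R S + slice true p q R S
  count-double p q R S = trans (count≡size double p q R S) (size-+ {n D} {n D} (between? double p q R S))

  layerCount : Bool → Fin (n D) → Fin (n D) → Fin (r D) → Fin (r D) → ℕ
  layerCount s a b R₀ S₀ = size (λ w → layer? s w ×-dec ((col D a w ≟ R₀) ×-dec (col D w b ≟ S₀)))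

  layerCount-false : ∀ a b R₀ S₀ → layerCount false a b R₀ S₀ ≡ count D a b R₀ S₀
  layerCount-false a b R₀ S₀ = sym (count≡size D a b R₀ S₀)

  layerCount-regular : ∀ s {a b a' b'} → a ∈ pts D → b ∈ pts D → a' ∈ pts D → b' ∈ pts D →
                       col D a b ≡ col D a' b' → ∀ R₀ S₀ → layerCount s a b R₀ S₀ ≡ layerCount s a' b' R₀ S₀
  layerCount-regular false {a} {b} {a'} {b'} pa pb pa' pb' e R₀ S₀ = begin
    layerCount false a b R₀ S₀   ≡⟨ layerCount-false a b R₀ S₀ ⟩
    count D a b R₀ S₀            ≡⟨ IsCC.regular ccD a b a' b' pa pb pa' pb' e R₀ S₀ ⟩
    count D a' b' R₀ S₀          ≡⟨ layerCount-false a' b' R₀ S₀ ⟨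
    layerCount false a' b' R₀ S₀ ∎
    where open ≡-Reasoning
  layerCount-regular true pa pb pa' pb' e = countThrough-regular pa pb pa' pb' e

  slice-compatible : ∀ s p q {t₁ t₂ t₃ t₄} R₀ S₀ → Compatible s (side p) (side q) t₁ t₂ t₃ t₄ →
                     slice s p q (tag t₁ t₂ R₀) (tag t₃ t₄ S₀) ≡ layerCount s (base p) (base q) R₀ S₀
  slice-compatible s p q R₀ S₀ (refl , refl , refl , refl) = size-cong {n D} _ _
    (λ a (pa , pa≡ , aq≡) → point∈double⁻ pa ,
       proj₂ (proj₂ (tag-injective (trans (sym (col-to-point p s a)) pa≡))) ,
       proj₂ (proj₂ (tag-injective (trans (sym (col-from-point q s a)) aq≡))))
    (λ a (la , pa≡ , aq≡) → point∈double la ,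
       trans (col-to-point p s a) (cong (tag _ _) pa≡) ,
       trans (col-from-point q s a) (cong (tag _ _) aq≡))

  slice-incompatible : ∀ s p q {t₁ t₂ t₃ t₄} R₀ S₀ → ¬ Compatible s (side p) (side q) t₁ t₂ t₃ t₄ →
                       slice s p q (tag t₁ t₂ R₀) (tag t₃ t₄ S₀) ≡ 0
  slice-incompatible s p q R₀ S₀ incompatible = size-empty {n D} _ λ a (_ , pa≡ , aq≡) →
    let e₁ , e₂ , _ = tag-injective (trans (sym (col-to-point p s a)) pa≡)
        e₃ , e₄ , _ = tag-injective (trans (sym (col-from-point q s a)) aq≡)
    in incompatible (e₁ , e₂ , e₃ , e₄)

  slice-regular : ∀ s {p q p' q'} → p ∈ pts double → q ∈ pts double → p' ∈ pts double → q' ∈ pts double →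
                  col double p q ≡ col double p' q' → ∀ R S → slice s p q R S ≡ slice s p' q' R S
  slice-regular s {p} {q} {p'} {q'} pp pq pp' pq' e R S
    with tag-surjective R | tag-surjective S | tag-injective e
  ... | t₁ , t₂ , R₀ , refl | t₃ , t₄ , S₀ , refl | sp≡sp' , sq≡sq' , c≡c'
    with compatible? s (side p) (side q) t₁ t₂ t₃ t₄
  ...   | yes (e₁ , e₂ , e₃ , e₄) = begin
    slice s p q (tag t₁ t₂ R₀) (tag t₃ t₄ S₀)     ≡⟨ slice-compatible s p q R₀ S₀ (e₁ , e₂ , e₃ , e₄) ⟩
    layerCount s (base p) (base q) R₀ S₀         ≡⟨ layerCount-regular s (∈double⇒base∈ pp) (∈double⇒base∈ pq)
                                                      (∈double⇒base∈ pp') (∈double⇒base∈ pq') c≡c' R₀ S₀ ⟩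
    layerCount s (base p') (base q') R₀ S₀       ≡⟨ slice-compatible s p' q' R₀ S₀
                                                      (trans (sym sp≡sp') e₁ , e₂ , e₃ , trans (sym sq≡sq') e₄) ⟨
    slice s p' q' (tag t₁ t₂ R₀) (tag t₃ t₄ S₀)   ∎
    where open ≡-Reasoning
  ...   | no incompatible = trans (slice-incompatible s p q R₀ S₀ incompatible)
          (sym (slice-incompatible s p' q' R₀ S₀ λ (e₁ , e₂ , e₃ , e₄) →
            incompatible (trans sp≡sp' e₁ , e₂ , e₃ , trans sq≡sq' e₄)))

  double-isCC : IsCC double
  double-isCC = record { loops = loops ; transpose = transpose ; regular = regular }
    where
    loops : ∀ u v w → u ∈ pts double → v ∈ pts double → w ∈ pts double →
            col double u u ≡ col double v w → v ≡ w
    loops u v w pu pv pw e with tag-injective e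
    ... | su≡sv , su≡sw , c≡c' = side-base-injective (trans (sym su≡sv) su≡sw)
      (IsCC.loops ccD (base u) (base v) (base w) (∈double⇒base∈ pu) (∈double⇒base∈ pv) (∈double⇒base∈ pw) c≡c')
    transpose : ∀ u v u' v' → u ∈ pts double → v ∈ pts double → u' ∈ pts double → v' ∈ pts double →
                col double u v ≡ col double u' v' → col double v u ≡ col double v' u'
    transpose u v u' v' pu pv pu' pv' e with tag-injective e
    ... | su≡su' , sv≡sv' , c≡c' = tag-cong sv≡sv' su≡su' (IsCC.transpose ccD (base u) (base v) (base u') (base v')
      (∈double⇒base∈ pu) (∈double⇒base∈ pv) (∈double⇒base∈ pu') (∈double⇒base∈ pv') c≡c')
    regular : ∀ u v u' v' → u ∈ pts double → v ∈ pts double → u' ∈ pts double → v' ∈ pts double →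
              col double u v ≡ col double u' v' → ∀ R S → count double u v R S ≡ count double u' v' R S
    regular u v u' v' pu pv pu' pv' e R S = begin
      count double u v R S                              ≡⟨ count-double u v R S ⟩
      slice false u v R S + slice true u v R S          ≡⟨ cong₂ _+_ (slice-regular false pu pv pu' pv' e R S)
                                                                      (slice-regular true pu pv pu' pv' e R S) ⟩
      slice false u' v' R S + slice true u' v' R S      ≡⟨ count-double u' v' R S ⟨
      count double u' v' R S                            ∎
      where open ≡-Reasoning

module LayerCountImage (E E' : Config) (ccE : IsCC E) (ccE' : IsCC E') (iso : AlgIso E E')
                       (j : Fin (r E)) (j-fiber : IsFiber E j) where
  open AlgIso iso
  open AlgIsoProperties E E' ccE ccE' iso using (numbers; f-loop-injective)
  open CountThroughImage E E' ccE ccE' iso j j-fiber using (countThrough-image)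
  private
    module L  = Doubling E ccE j
    module L′ = Doubling E' ccE' (f j)

  layerCount-image : ∀ s {a b a' b'} → a ∈ pts E → b ∈ pts E → a' ∈ pts E' → b' ∈ pts E' →
                     col E' a' b' ≡ f (col E a b) → ∀ {R S} → Used E R → Used E S →
                     L′.layerCount s a' b' (f R) (f S) ≡ L.layerCount s a b R S
  layerCount-image false {a} {b} {a'} {b'} pa pb pa' pb' e {R} {S} uR uS = begin
    L′.layerCount false a' b' (f R) (f S) ≡⟨ L′.layerCount-false a' b' (f R) (f S) ⟩
    count E' a' b' (f R) (f S)            ≡⟨ numbers pa pb pa' pb' e uR uS ⟩
    count E a b R S                       ≡⟨ L.layerCount-false a b R S ⟨
    L.layerCount false a b R S            ∎
    where open ≡-Reasoning
  layerCount-image true = countThrough-image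

  layer-image : ∀ s {x a} → L.Layer s x → a ∈ pts E' → col E' a a ≡ f (col E x x) → L′.Layer s a
  layer-image false _            pa _      = pa
  layer-image true  (_ , xx≡j)  pa aa≡fxx = pa , trans aa≡fxx (cong f xx≡j)

  layer-preimage : ∀ s {x a} → L′.Layer s a → x ∈ pts E → col E' a a ≡ f (col E x x) → L.Layer s x
  layer-preimage false _             px _      = px
  layer-preimage true  (_ , aa≡fj)  px aa≡fxx = px , f-loop-injective j-fiber px (trans (sym aa≡fxx) aa≡fj)

module Folding (C : Config) (ccC : IsCC C) {i j : Fin (r C)} (i≢j : i ≢ j) (matching : HasMatching C i j) where
  open Matching matching
  open CoherentProperties C ccC

  Cᵢ : Config
  Cᵢ = removeFiber C i

  Cᵢ-isCC : IsCC Cᵢ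
  Cᵢ-isCC = CountsThroughFiber.removeFiber-isCC C ccC i

  open Doubling Cᵢ Cᵢ-isCC j using (Layer; layerCount)

  σ : Fin (n C) → Bool
  σ u = does (inFiber? C i u)

  π′ : ∀ u → Dec (InFiber C i u) → Fin (n C)
  π′ u (yes u∈X) = partner u∈X
  π′ u (no  _)   = u

  π : Fin (n C) → Fin (n C)
  π u = π′ u (inFiber? C i u)

  private
    σ-π-inside′ : ∀ {u} → InFiber C i u → (d : Dec (InFiber C i u)) →
                  does d ≡ true × π′ u d ∈ pts C × col C u (π′ u d) ≡ k
    σ-π-inside′ u∈X (yes u∈X′) = refl , partner-pts u∈X′ , partner-col u∈X′
    σ-π-inside′ u∈X (no  u∉X)  = ⊥-elim (u∉X u∈X)

    σ-π-outside′ : ∀ {u} → col C u u ≢ i → (d : Dec (InFiber C i u)) → does d ≡ false × π′ u d ≡ u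
    σ-π-outside′ uu≢i (yes (_ , uu≡i)) = ⊥-elim (uu≢i uu≡i)
    σ-π-outside′ uu≢i (no  _)          = refl , refl

  σ-π-inside : ∀ {u} → InFiber C i u → σ u ≡ true × π u ∈ pts C × col C u (π u) ≡ k
  σ-π-inside {u} u∈X = σ-π-inside′ u∈X (inFiber? C i u)

  σ-π-outside : ∀ {u} → col C u u ≢ i → σ u ≡ false × π u ≡ u
  σ-π-outside {u} uu≢i = σ-π-outside′ uu≢i (inFiber? C i u)

  σ≡true⇒ : ∀ {u} → σ u ≡ true → col C u u ≡ i
  σ≡true⇒ {u} σu≡true = by-fiber C i u (λ uu≡i → uu≡i)
    (λ uu≢i → contradiction (trans (sym σu≡true) (proj₁ (σ-π-outside uu≢i))) λ ())

  σ≡false⇒ : ∀ {u} → u ∈ pts C → σ u ≡ false → col C u u ≢ i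
  σ≡false⇒ pu σu≡false uu≡i = contradiction (trans (sym (proj₁ (σ-π-inside (pu , uu≡i)))) σu≡false) λ ()

  π-fiber : ∀ {u} → InFiber C i u → InFiber C j (π u)
  π-fiber u∈X@(pu , _) = let _ , pπu , uπu≡k = σ-π-inside u∈X in proj₂ (matching-ends pu pπu uπu≡k)

  π-pts : ∀ {u} → u ∈ pts C → π u ∈ pts C
  π-pts {u} pu = by-fiber C i u (λ uu≡i → proj₁ (proj₂ (σ-π-inside (pu , uu≡i))))
    (λ uu≢i → subst (_∈ pts C) (sym (proj₂ (σ-π-outside uu≢i))) pu)

  π-layer : ∀ {u} → u ∈ pts C → Layer (σ u) (π u)
  π-layer {u} pu = by-fiber C i u
    (λ uu≡i → let pπu , πuπu≡j = π-fiber (pu , uu≡i) in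
      subst (λ s → Layer s (π u)) (sym (proj₁ (σ-π-inside (pu , uu≡i))))
        (∈removeFiber⁺ C i pπu (λ πuπu≡i → i≢j (trans (sym πuπu≡i) πuπu≡j)) , πuπu≡j))
    (λ uu≢i → subst₂ Layer (sym (proj₁ (σ-π-outside uu≢i))) (sym (proj₂ (σ-π-outside uu≢i)))
      (∈removeFiber⁺ C i pu uu≢i))

  π∈Cᵢ : ∀ {u} → u ∈ pts C → π u ∈ pts Cᵢ
  π∈Cᵢ {u} pu = Doubling.layer⇒pts Cᵢ Cᵢ-isCC j (π-layer pu)

  σ-cong : ∀ {u u'} → u ∈ pts C → u' ∈ pts C → col C u u ≡ col C u' u' → σ u ≡ σ u'
  σ-cong {u} {u'} pu pu' uu≡u'u' = by-fiber C i u
    (λ uu≡i → trans (proj₁ (σ-π-inside (pu , uu≡i))) (sym (proj₁ (σ-π-inside (pu' , trans (sym uu≡u'u') uu≡i)))))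
    (λ uu≢i → trans (proj₁ (σ-π-outside uu≢i))
                (sym (proj₁ (σ-π-outside λ u'u'≡i → uu≢i (trans uu≡u'u' u'u'≡i)))))

  -- Since k is a matching, x ↦ y (with col x y = k) is the unique k-step from x, so colours
  -- leaving x and leaving y determine each other.
  partner-shift : ∀ {x x' y y' b b'} → x ∈ pts C → InFiber C i x' → y ∈ pts C → col C x y ≡ k →
                  y' ∈ pts C → col C x' y' ≡ k → b ∈ pts C → b' ∈ pts C →
                  col C x b ≡ col C x' b' → col C y b ≡ col C y' b'
  partner-shift {x} {x'} {y} {y'} {b} {b'} px x'∈X py xy≡k py' x'y'≡k pb pb' xb≡x'b'
    with count-witness C (subst (1 ≤_) (IsCC.regular ccC x b x' b' px pb (proj₁ x'∈X) pb' xb≡x'b' (col C x y) (col C y b))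
                                        (count-positive C y (py , refl , refl)))
  ... | w , pw , x'w≡xy , wb'≡yb = trans (sym wb'≡yb) (cong (λ z → col C z b') w≡y')
    where
    w≡y' : w ≡ y'
    w≡y' = trans (partner-unique x'∈X pw (trans x'w≡xy xy≡k)) (sym (partner-unique x'∈X py' x'y'≡k))

  partner-unshift : ∀ {x x' y y' b b'} → x ∈ pts C → x' ∈ pts C → y ∈ pts C → col C x y ≡ k →
                    y' ∈ pts C → col C x' y' ≡ k → b ∈ pts C → b' ∈ pts C →
                    col C y b ≡ col C y' b' → col C x b ≡ col C x' b'
  partner-unshift {x} {x'} {y} {y'} {b} {b'} px px' py xy≡k py' x'y'≡k pb pb' yb≡y'b'
    with count-witness C (subst (1 ≤_) (IsCC.regular ccC y b y' b' py pb py' pb' yb≡y'b' (col C y x) (col C x b))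
                                        (count-positive C x (px , refl , refl)))
  ... | w , pw , y'w≡yx , wb'≡xb = trans (sym wb'≡xb) (cong (λ z → col C z b') w≡x')
    where
    y'∈Y = proj₂ (matching-ends px' py' x'y'≡k)
    w≡x' : w ≡ x'
    w≡x' = trans (copartner-unique y'∈Y pw (trans (IsCC.transpose ccC y' w y x py' pw py px y'w≡yx) xy≡k))
                 (sym (copartner-unique y'∈Y px' x'y'≡k))

  π-left : ∀ {u u' b b'} → u ∈ pts C → u' ∈ pts C → b ∈ pts C → b' ∈ pts C →
           col C u b ≡ col C u' b' → col C (π u) b ≡ col C (π u') b'
  π-left {u} {u'} {b} {b'} pu pu' pb pb' ub≡u'b' = by-fiber C i u
    (λ uu≡i →
      let u'u'≡i = trans (sym (src-fiber-cong pu pb pu' pb' ub≡u'b')) uu≡i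
          _ , pπu , uπu≡k = σ-π-inside (pu , uu≡i)
          _ , pπu' , u'πu'≡k = σ-π-inside (pu' , u'u'≡i)
      in partner-shift pu (pu' , u'u'≡i) pπu uπu≡k pπu' u'πu'≡k pb pb' ub≡u'b')
    (λ uu≢i →
      let u'u'≢i = λ u'u'≡i → uu≢i (trans (src-fiber-cong pu pb pu' pb' ub≡u'b') u'u'≡i)
      in subst₂ (λ x x' → col C x b ≡ col C x' b') (sym (proj₂ (σ-π-outside uu≢i)))
           (sym (proj₂ (σ-π-outside u'u'≢i))) ub≡u'b')

  π-left⁻ : ∀ {u u' b b'} → u ∈ pts C → u' ∈ pts C → b ∈ pts C → b' ∈ pts C → σ u ≡ σ u' →
            col C (π u) b ≡ col C (π u') b' → col C u b ≡ col C u' b'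
  π-left⁻ {u} {u'} {b} {b'} pu pu' pb pb' σu≡σu' πub≡πu'b' = by-fiber C i u
    (λ uu≡i →
      let u'u'≡i = σ≡true⇒ (trans (sym σu≡σu') (proj₁ (σ-π-inside (pu , uu≡i))))
          _ , pπu , uπu≡k = σ-π-inside (pu , uu≡i)
          _ , pπu' , u'πu'≡k = σ-π-inside (pu' , u'u'≡i)
      in partner-unshift pu pu' pπu uπu≡k pπu' u'πu'≡k pb pb' πub≡πu'b')
    (λ uu≢i →
      let u'u'≢i = σ≡false⇒ pu' (trans (sym σu≡σu') (proj₁ (σ-π-outside uu≢i)))
      in subst₂ (λ x x' → col C x b ≡ col C x' b') (proj₂ (σ-π-outside uu≢i)) (proj₂ (σ-π-outside u'u'≢i))
           πub≡πu'b')

  π-right : ∀ {a a' v v'} → a ∈ pts C → a' ∈ pts C → v ∈ pts C → v' ∈ pts C →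
            col C a v ≡ col C a' v' → col C a (π v) ≡ col C a' (π v')
  π-right pa pa' pv pv' av≡a'v' = IsCC.transpose ccC _ _ _ _ (π-pts pv) pa (π-pts pv') pa'
    (π-left pv pv' pa pa' (IsCC.transpose ccC _ _ _ _ pa pv pa' pv' av≡a'v'))

  π-right⁻ : ∀ {a a' v v'} → a ∈ pts C → a' ∈ pts C → v ∈ pts C → v' ∈ pts C → σ v ≡ σ v' →
             col C a (π v) ≡ col C a' (π v') → col C a v ≡ col C a' v'
  π-right⁻ pa pa' pv pv' σv≡σv' aπv≡a'πv' = IsCC.transpose ccC _ _ _ _ pv pa pv' pa'
    (π-left⁻ pv pv' pa pa' σv≡σv' (IsCC.transpose ccC _ _ _ _ pa (π-pts pv) pa' (π-pts pv') aπv≡a'πv'))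

  fold-col : ∀ {u v u' v'} → u ∈ pts C → v ∈ pts C → u' ∈ pts C → v' ∈ pts C → col C u v ≡ col C u' v' →
             σ u ≡ σ u' × σ v ≡ σ v' × col C (π u) (π v) ≡ col C (π u') (π v')
  fold-col pu pv pu' pv' uv≡u'v' =
    σ-cong pu pu' (src-fiber-cong pu pv pu' pv' uv≡u'v') ,
    σ-cong pv pv' (tgt-fiber-cong pu pv pu' pv' uv≡u'v') ,
    π-right (π-pts pu) (π-pts pu') pv pv' (π-left pu pu' pv pv' uv≡u'v')

  unfold-col : ∀ {u v u' v'} → u ∈ pts C → v ∈ pts C → u' ∈ pts C → v' ∈ pts C → σ u ≡ σ u' → σ v ≡ σ v' →
               col C (π u) (π v) ≡ col C (π u') (π v') → col C u v ≡ col C u' v'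
  unfold-col pu pv pu' pv' σu≡σu' σv≡σv' πuπv≡πu'πv' =
    π-left⁻ pu pu' pv pv' σu≡σu' (π-right⁻ (π-pts pu) (π-pts pu') pv pv' σv≡σv' πuπv≡πu'πv')

  π-injective : ∀ {w w'} → w ∈ pts C → w' ∈ pts C → σ w ≡ σ w' → π w ≡ π w' → w ≡ w'
  π-injective {w} {w'} pw pw' σw≡σw' πw≡πw' = by-fiber C i w
    (λ ww≡i →
      let w'w'≡i = σ≡true⇒ (trans (sym σw≡σw') (proj₁ (σ-π-inside (pw , ww≡i))))
          _ , _ , wπw≡k = σ-π-inside (pw , ww≡i)
          _ , _ , w'πw'≡k = σ-π-inside (pw' , w'w'≡i)
          πw∈Y = π-fiber (pw , ww≡i)
      in trans (copartner-unique πw∈Y pw wπw≡k)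
               (sym (copartner-unique πw∈Y pw' (subst (λ z → col C w' z ≡ k) (sym πw≡πw') w'πw'≡k))))
    (λ ww≢i →
      let w'w'≢i = σ≡false⇒ pw' (trans (sym σw≡σw') (proj₁ (σ-π-outside ww≢i)))
      in trans (sym (proj₂ (σ-π-outside ww≢i))) (trans πw≡πw' (proj₂ (σ-π-outside w'w'≢i))))

  lift : ∀ s {y} → Layer s y → Σ (Fin (n C)) λ w → w ∈ pts C × σ w ≡ s × π w ≡ y
  lift false {y} py = y , ∈removeFiber⇒∈ C i py , σ-π-outside (proj₂ (∈removeFiber⁻ C i py))
  lift true {y} (py , yy≡j) = x , px , σx≡true ,
    trans (partner-unique x∈X πx∈ xπx≡k) (sym (partner-unique x∈X py₀ (copartner-col y∈Y)))
    where
    py₀ = ∈removeFiber⇒∈ C i py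
    y∈Y : InFiber C j y
    y∈Y = py₀ , yy≡j
    x = copartner y∈Y
    px = copartner-pts y∈Y
    x∈X = copartner-fiber y∈Y
    σx≡true = proj₁ (σ-π-inside x∈X)
    πx∈ = proj₁ (proj₂ (σ-π-inside x∈X))
    xπx≡k = proj₂ (proj₂ (σ-π-inside x∈X))

  part : Bool → Fin (n C) → Fin (n C) → Fin (r C) → Fin (r C) → ℕ
  part s u v R S = size (λ w → (w ∈? pts C) ×-dec ((σ w Bool.≟ s) ×-dec ((col C u w ≟ R) ×-dec (col C w v ≟ S))))

  count≡parts : ∀ u v R S → count C u v R S ≡ part false u v R S + part true u v R S
  count≡parts u v R S = begin
    count C u v R S
      ≡⟨ count≡size C u v R S ⟩
    size (between? C u v R S)
      ≡⟨ size-partition {n C} (between? C u v R S) (λ w → σ w Bool.≟ false) ⟩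
    size (λ w → between? C u v R S w ×-dec (σ w Bool.≟ false)) +
    size (λ w → between? C u v R S w ×-dec ¬? (σ w Bool.≟ false))
      ≡⟨ cong₂ _+_
           (size-cong {n C} _ _ (λ w ((pw , rest) , σw≡false) → pw , σw≡false , rest)
                                (λ w (pw , σw≡false , rest) → (pw , rest) , σw≡false))
           (size-cong {n C} _ _ (λ w ((pw , rest) , σw≢false) → pw , ≢false⇒≡true σw≢false , rest)
                                (λ w (pw , σw≡true , rest) → (pw , rest) , λ σw≡false →
                                   contradiction (trans (sym σw≡true) σw≡false) λ ())) ⟩
    part false u v R S + part true u v R S ∎
    where
    open ≡-Reasoning
    ≢false⇒≡true : ∀ {b} → b ≢ false → b ≡ true
    ≢false⇒≡true {false} b≢false = ⊥-elim (b≢false refl)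
    ≢false⇒≡true {true}  _       = refl

  module _ (s : Bool) {u v r₁ r₂ s₁ s₂ : Fin (n C)} (pu : u ∈ pts C) (pv : v ∈ pts C)
           (pr₁ : r₁ ∈ pts C) (pr₂ : r₂ ∈ pts C) (ps₁ : s₁ ∈ pts C) (ps₂ : s₂ ∈ pts C) where

    part-incompatible : ¬ Compatible s (σ u) (σ v) (σ r₁) (σ r₂) (σ s₁) (σ s₂) →
                        part s u v (col C r₁ r₂) (col C s₁ s₂) ≡ 0
    part-incompatible incompatible = size-empty {n C} _ λ w (pw , σw≡s , uw≡ , wv≡) →
      let σu≡σr₁ , σw≡σr₂ , _ = fold-col pu pw pr₁ pr₂ uw≡
          σw≡σs₁ , σv≡σs₂ , _ = fold-col pw pv ps₁ ps₂ wv≡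
      in incompatible (σu≡σr₁ , trans (sym σw≡s) σw≡σr₂ , trans (sym σw≡s) σw≡σs₁ , σv≡σs₂)

    part-compatible : Compatible s (σ u) (σ v) (σ r₁) (σ r₂) (σ s₁) (σ s₂) →
                      part s u v (col C r₁ r₂) (col C s₁ s₂) ≡
                      layerCount s (π u) (π v) (col C (π r₁) (π r₂)) (col C (π s₁) (π s₂))
    part-compatible (σu≡σr₁ , s≡σr₂ , s≡σs₁ , σv≡σs₂) = size-bijection {n C} {n C} _ _ π
      (λ w (pw , σw≡s , uw≡ , wv≡) →
        subst (λ t → Layer t (π w)) σw≡s (π-layer pw) ,
        proj₂ (proj₂ (fold-col pu pw pr₁ pr₂ uw≡)) ,
        proj₂ (proj₂ (fold-col pw pv ps₁ ps₂ wv≡)))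
      (λ w w' (pw , σw≡s , _) (pw' , σw'≡s , _) → π-injective pw pw' (trans σw≡s (sym σw'≡s)))
      (λ y (ly , πu-y≡ , y-πv≡) →
        let w , pw , σw≡s , πw≡y = lift s ly in
        w , (pw , σw≡s ,
             unfold-col pu pw pr₁ pr₂ σu≡σr₁ (trans σw≡s s≡σr₂) (subst (λ z → col C (π u) z ≡ _) (sym πw≡y) πu-y≡) ,
             unfold-col pw pv ps₁ ps₂ (trans σw≡s s≡σs₁) σv≡σs₂ (subst (λ z → col C z (π v) ≡ _) (sym πw≡y) y-πv≡)) ,
        πw≡y)

module Unfolding (C : Config) (ccC : IsCC C) {i j : Fin (r C)} (j-fiber : IsFiber C j) (i≢j : i ≢ j)
                 (matching : HasMatching C i j) (D' : Config) (ccD' : IsCC D')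
                 (iso : AlgIso (removeFiber C i) D') where
  open Folding C ccC i≢j matching
  open AlgIso iso renaming (f to f'; f-used to f'-used; f-inj to f'-inj; f-surj to f'-surj)
  open AlgIsoProperties Cᵢ D' Cᵢ-isCC ccD' iso using (numbers; src-loop-image; tgt-loop-image)
  open Doubling D' ccD' (f' j)

  j-fiberᵢ : IsFiber Cᵢ j
  j-fiberᵢ = let y₀ , py₀ , y₀y₀≡j = j-fiber in
    y₀ , ∈removeFiber⁺ C i py₀ (λ y₀y₀≡i → i≢j (trans (sym y₀y₀≡i) y₀y₀≡j)) , y₀y₀≡j

  open LayerCountImage Cᵢ D' Cᵢ-isCC ccD' iso j j-fiberᵢ

  usedᵢ : ∀ {u v} → u ∈ pts C → v ∈ pts C → Used Cᵢ (col C (π u) (π v))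
  usedᵢ pu pv = used Cᵢ (π∈Cᵢ pu) (π∈Cᵢ pv)

  -- The value on unused colours is irrelevant.
  F′ : ∀ t → Dec (Used C t) → Fin (r double)
  F′ t (yes (u , v , _)) = tag (σ u) (σ v) (f' (col C (π u) (π v)))
  F′ t (no  _)           = tag false false (f' t)

  F : Fin (r C) → Fin (r double)
  F t = F′ t (used? C t)

  private
    F′-col : ∀ {u v} → u ∈ pts C → v ∈ pts C → (d : Dec (Used C (col C u v))) →
             F′ (col C u v) d ≡ tag (σ u) (σ v) (f' (col C (π u) (π v)))
    F′-col pu pv (yes (u₀ , v₀ , pu₀ , pv₀ , u₀v₀≡uv)) =
      let σu₀≡σu , σv₀≡σv , πu₀πv₀≡πuπv = fold-col pu₀ pv₀ pu pv u₀v₀≡uv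
      in tag-cong σu₀≡σu σv₀≡σv (cong f' πu₀πv₀≡πuπv)
    F′-col pu pv (no unused) = ⊥-elim (unused (used C pu pv))

  F-col : ∀ {u v} → u ∈ pts C → v ∈ pts C → F (col C u v) ≡ tag (σ u) (σ v) (f' (col C (π u) (π v)))
  F-col {u} {v} pu pv = F′-col pu pv (used? C (col C u v))

  F-used : ∀ t → Used C t → Used double (F t)
  F-used t (u , v , pu , pv , uv≡t) = point (σ u) a , point (σ v) b , point∈double la , point∈double lb ,
    (begin
      col double (point (σ u) a) (point (σ v) b)     ≡⟨ col-point-point (σ u) a (σ v) b ⟩
      tag (σ u) (σ v) (col D' a b)                   ≡⟨ cong (tag (σ u) (σ v)) ab≡ ⟩
      tag (σ u) (σ v) (f' (col C (π u) (π v)))       ≡⟨ F-col pu pv ⟨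
      F (col C u v)                                  ≡⟨ cong F uv≡t ⟩
      F t                                            ∎)
    where
    open ≡-Reasoning
    image = f'-used _ (usedᵢ pu pv)
    a = proj₁ image
    b = proj₁ (proj₂ image)
    pa = proj₁ (proj₂ (proj₂ image))
    pb = proj₁ (proj₂ (proj₂ (proj₂ image)))
    ab≡ : col D' a b ≡ f' (col C (π u) (π v))
    ab≡ = proj₂ (proj₂ (proj₂ (proj₂ image)))
    la = layer-image (σ u) (π-layer pu) pa (src-loop-image (π∈Cᵢ pu) (π∈Cᵢ pv) pa pb ab≡)
    lb = layer-image (σ v) (π-layer pv) pb (tgt-loop-image (π∈Cᵢ pu) (π∈Cᵢ pv) pa pb ab≡)

  F-inj : ∀ t t' → Used C t → Used C t' → F t ≡ F t' → t ≡ t'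
  F-inj t t' (u , v , pu , pv , uv≡t) (u' , v' , pu' , pv' , u'v'≡t') Ft≡Ft' =
    let σu≡σu' , σv≡σv' , fc≡fc' = tag-injective (trans (sym (F-col pu pv))
                                     (trans (cong F uv≡t) (trans Ft≡Ft' (trans (cong F (sym u'v'≡t')) (F-col pu' pv')))))
    in trans (sym uv≡t)
         (trans (unfold-col pu pv pu' pv' σu≡σu' σv≡σv' (f'-inj _ _ (usedᵢ pu pv) (usedᵢ pu' pv') fc≡fc')) u'v'≡t')

  F-surj : ∀ k' → Used double k' → Σ (Fin (r C)) λ t → Used C t × F t ≡ k'
  F-surj k' (p , q , pp , pq , pq≡k') = col C u v , used C pu pv ,
    (begin
      F (col C u v)                               ≡⟨ F-col pu pv ⟩
      tag (σ u) (σ v) (f' (col C (π u) (π v)))    ≡⟨ tag-cong σu≡ σv≡ (trans (cong f' (cong₂ (col C) πu≡ πv≡)) (sym bpbq≡)) ⟩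
      tag (side p) (side q) (col D' (base p) (base q)) ≡⟨ pq≡k' ⟩
      k'                                          ∎)
    where
    open ≡-Reasoning
    preimage = f'-surj (col D' (base p) (base q)) (used D' (∈double⇒base∈ pp) (∈double⇒base∈ pq))
    u₀ = proj₁ (proj₁ (proj₂ preimage))
    v₀ = proj₁ (proj₂ (proj₁ (proj₂ preimage)))
    pu₀ : u₀ ∈ pts Cᵢ
    pu₀ = proj₁ (proj₂ (proj₂ (proj₁ (proj₂ preimage))))
    pv₀ : v₀ ∈ pts Cᵢ
    pv₀ = proj₁ (proj₂ (proj₂ (proj₂ (proj₁ (proj₂ preimage)))))
    bpbq≡ : col D' (base p) (base q) ≡ f' (col C u₀ v₀)
    bpbq≡ = trans (sym (proj₂ (proj₂ preimage))) (cong f' (sym (proj₂ (proj₂ (proj₂ (proj₂ (proj₁ (proj₂ preimage))))))))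
    lu = lift (side p) (layer-preimage (side p) (∈double⁻ pp) pu₀
           (src-loop-image pu₀ pv₀ (∈double⇒base∈ pp) (∈double⇒base∈ pq) bpbq≡))
    lv = lift (side q) (layer-preimage (side q) (∈double⁻ pq) pv₀
           (tgt-loop-image pu₀ pv₀ (∈double⇒base∈ pp) (∈double⇒base∈ pq) bpbq≡))
    u = proj₁ lu
    v = proj₁ lv
    pu : u ∈ pts C
    pu = proj₁ (proj₂ lu)
    pv : v ∈ pts C
    pv = proj₁ (proj₂ lv)
    σu≡ : σ u ≡ side p
    σu≡ = proj₁ (proj₂ (proj₂ lu))
    σv≡ : σ v ≡ side q
    σv≡ = proj₁ (proj₂ (proj₂ lv))
    πu≡ : π u ≡ u₀
    πu≡ = proj₂ (proj₂ (proj₂ lu))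
    πv≡ : π v ≡ v₀
    πv≡ = proj₂ (proj₂ (proj₂ lv))

  -- Both counts split by the side of the middle point, and the two splittings agree side by side.
  F-numbers : ∀ R S → Used C R → Used C S → ∀ u v p q → u ∈ pts C → v ∈ pts C → p ∈ pts double → q ∈ pts double →
              col double p q ≡ F (col C u v) → count double p q (F R) (F S) ≡ count C u v R S
  F-numbers _ _ (r₁ , r₂ , pr₁ , pr₂ , refl) (s₁ , s₂ , ps₁ , ps₂ , refl) u v p q pu pv pp pq pq≡ = begin
    count double p q (F (col C r₁ r₂)) (F (col C s₁ s₂)) ≡⟨ cong₂ (count double p q) (F-col pr₁ pr₂) (F-col ps₁ ps₂) ⟩
    count double p q R′ S′                                ≡⟨ count-double p q R′ S′ ⟩
    slice false p q R′ S′ + slice true p q R′ S′          ≡⟨ cong₂ _+_ (slice≡part false) (slice≡part true) ⟩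
    part false u v R S + part true u v R S                ≡⟨ count≡parts u v R S ⟨
    count C u v R S                                       ∎
    where
    open ≡-Reasoning
    R = col C r₁ r₂
    S = col C s₁ s₂
    R₀ = col C (π r₁) (π r₂)
    S₀ = col C (π s₁) (π s₂)
    R′ = tag (σ r₁) (σ r₂) (f' R₀)
    S′ = tag (σ s₁) (σ s₂) (f' S₀)
    sides = tag-injective (trans pq≡ (F-col pu pv))
    sp≡σu : side p ≡ σ u
    sp≡σu = proj₁ sides
    sq≡σv : side q ≡ σ v
    sq≡σv = proj₁ (proj₂ sides)
    bpbq≡ : col D' (base p) (base q) ≡ f' (col C (π u) (π v))
    bpbq≡ = proj₂ (proj₂ sides)
    slice≡part′ : ∀ s → Dec (Compatible s (σ u) (σ v) (σ r₁) (σ r₂) (σ s₁) (σ s₂)) →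
                  slice s p q R′ S′ ≡ part s u v R S
    slice≡part′ s (yes c@(e₁ , e₂ , e₃ , e₄)) = begin
      slice s p q R′ S′                                ≡⟨ slice-compatible s p q (f' R₀) (f' S₀)
                                                            (trans sp≡σu e₁ , e₂ , e₃ , trans sq≡σv e₄) ⟩
      layerCount s (base p) (base q) (f' R₀) (f' S₀)   ≡⟨ layerCount-image s (π∈Cᵢ pu) (π∈Cᵢ pv)
                                                            (∈double⇒base∈ pp) (∈double⇒base∈ pq) bpbq≡
                                                            (usedᵢ pr₁ pr₂) (usedᵢ ps₁ ps₂) ⟩
      Doubling.layerCount Cᵢ Cᵢ-isCC j s (π u) (π v) R₀ S₀ ≡⟨ part-compatible s pu pv pr₁ pr₂ ps₁ ps₂ c ⟨
      part s u v R S                                   ∎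
    slice≡part′ s (no incompatible) = trans
      (slice-incompatible s p q (f' R₀) (f' S₀)
        (λ (e₁ , e₂ , e₃ , e₄) → incompatible (trans (sym sp≡σu) e₁ , e₂ , e₃ , trans (sym sq≡σv) e₄)))
      (sym (part-incompatible s pu pv pr₁ pr₂ ps₁ ps₂ incompatible))
    slice≡part : ∀ s → slice s p q R′ S′ ≡ part s u v R S
    slice≡part s = slice≡part′ s (compatible? s (σ u) (σ v) (σ r₁) (σ r₂) (σ s₁) (σ s₂))

  unfoldingIso : AlgIso C double
  unfoldingIso = record { f = F ; f-used = F-used ; f-inj = F-inj ; f-surj = F-surj ; f-numbers = F-numbers }

  module _ (induced : Induces C double unfoldingIso) where
    open Induces induced renaming (φ to Φ; φ-pts to Φ-pts; φ-inj to Φ-inj; φ-surj to Φ-surj; φ-col to Φ-col)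

    private
      fromCᵢ : ∀ {u} → u ∈ pts Cᵢ → u ∈ pts C
      fromCᵢ = ∈removeFiber⇒∈ C i

      F-colᵢ : ∀ {u v} → u ∈ pts Cᵢ → v ∈ pts Cᵢ → F (col C u v) ≡ tag false false (f' (col C u v))
      F-colᵢ {u} {v} pu pv =
        let σu≡false , πu≡u = σ-π-outside (proj₂ (∈removeFiber⁻ C i pu))
            σv≡false , πv≡v = σ-π-outside (proj₂ (∈removeFiber⁻ C i pv))
        in trans (F-col (fromCᵢ pu) (fromCᵢ pv)) (tag-cong σu≡false σv≡false (cong f' (cong₂ (col C) πu≡u πv≡v)))

    Φ-restricted : ∀ {u v} → u ∈ pts Cᵢ → v ∈ pts Cᵢ →
                   side (Φ u) ≡ false × side (Φ v) ≡ false × col D' (base (Φ u)) (base (Φ v)) ≡ f' (col C u v)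
    Φ-restricted pu pv = tag-injective (trans (Φ-col _ _ (fromCᵢ pu) (fromCᵢ pv)) (F-colᵢ pu pv))

    restricted-surj : ∀ a → a ∈ pts D' → Σ (Fin (n C)) λ u → u ∈ pts Cᵢ × base (Φ u) ≡ a
    restricted-surj a pa = u , ∈removeFiber⁺ C i pu (σ≡false⇒ pu σu≡false) , trans (cong base Φu≡) (base-point false a)
      where
      preimage = Φ-surj (point false a) (point∈double pa)
      u = proj₁ preimage
      pu : u ∈ pts C
      pu = proj₁ (proj₂ preimage)
      Φu≡ : Φ u ≡ point false a
      Φu≡ = proj₂ (proj₂ preimage)
      σu≡false : σ u ≡ false
      σu≡false = sym (proj₁ (tag-injective (begin
        tag false false (col D' a a)                 ≡⟨ col-point-point false a false a ⟨
        col double (point false a) (point false a)   ≡⟨ cong₂ (col double) Φu≡ Φu≡ ⟨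
        col double (Φ u) (Φ u)                       ≡⟨ Φ-col u u pu pu ⟩
        F (col C u u)                                ≡⟨ F-col pu pu ⟩
        tag (σ u) (σ u) (f' (col C (π u) (π u)))     ∎)))
        where open ≡-Reasoning

    restriction : Induces Cᵢ D' iso
    restriction = record
      { φ      = λ u → base (Φ u)
      ; φ-pts  = λ u pu → ∈double⇒base∈ (Φ-pts u (fromCᵢ pu))
      ; φ-inj  = λ u v pu pv bΦu≡bΦv → Φ-inj u v (fromCᵢ pu) (fromCᵢ pv)
                   (side-base-injective (trans (proj₁ (Φ-restricted pu pv)) (sym (proj₁ (proj₂ (Φ-restricted pu pv)))))
                                        bΦu≡bΦv)
      ; φ-surj = restricted-surj
      ; φ-col  = λ u v pu pv → proj₂ (proj₂ (Φ-restricted pu pv)) }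

lemma4p1 : (C : Config) → IsCC C → (i j : Fin (r C)) → IsFiber C i → IsFiber C j → i ≢ j →
           HasMatching C i j → Separable C ⇔ Separable (removeFiber C i)
lemma4p1 C cc i j i-fiber j-fiber i≢j matching = mk⇔ separable-removal separable-extension
  where
  separable-removal : Separable C → Separable (removeFiber C i)
  separable-removal sepC D' ccD' iso = restriction (sepC _ (Doubling.double-isCC D' ccD' _) unfoldingIso)
    where open Unfolding C cc j-fiber i≢j matching D' ccD' iso

  separable-extension : Separable (removeFiber C i) → Separable C
  separable-extension sepCᵢ D ccD iso = ExtendAlongMatching.extension C D cc ccD iso i-fiber j-fiber i≢j matching
    (sepCᵢ (removeFiber D (AlgIso.f iso i)) (CountsThroughFiber.removeFiber-isCC D ccD (AlgIso.f iso i))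
           (RestrictedIso.restrictedIso C D cc ccD iso i i-fiber))
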